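{- Let $H$ be a non-empty connected graph. Then for every non-empty, irreflexive and connected graph $G$, $$\mathrm{comp}(G\to H)=\sum_{J\in\mathcal{S}_H}\lambda_H(J)\,\hom(G\to J),$$ where $\mathrm{comp}(G\to H)$ is the number of compactions from $G$ to $H$ and $\hom(G\to J)$ the number of homomorphisms from $G$ to $J$.
   Context: Graphs are finite, undirected, possibly with loops; irreflexive means no loops; non-empty means at least one vertex. A homomorphism $h:V(G)\to V(H)$ maps each edge of $G$ to an edge of $H$; a compaction is a homomorphism that uses every vertex of $H$ and every non-loop edge of $H$ (it uses an edge $\{w_1,w_2\}$ if some edge $\{u_1,u_2\}$ of $G$ has $h(u_1)=w_1,h(u_2)=w_2$). A subgraph $H'$ of $H$ is loop-hereditary if every vertex of $H'$ that has a loop in $H$ also has a loop in $H'$. For connected $H$, $\mathrm{Sub}(H)$ is the set of non-empty, loop-hereditary, connected subgraphs of $H$; $\mathcal{S}_H$ is a set containing exactly one representative of each isomorphism class of graphs in $\mathrm{Sub}(H)$; for $H'\in\mathcal{S}_H$, $\mu_H(H')$ is the number of graphs in $\mathrm{Sub}(H)$ isomorphic to $H'$. For each non-empty connected graph $H$ a weight $\lambda_H(J)\in\mathbb{Z}$ is defined for every non-empty connected graph $J$ by: $\lambda_H(J)=0$ if $J$ is isomorphic to no graph in $\mathcal{S}_H$; $\lambda_H(J)=1$ if $J\cong H$; otherwise (inductively, on graphs smaller than $H$ in number of vertices, then number of edges) $\lambda_H(J)=-\sum_{H'\in\mathcal{S}_H,\ H'\not\cong H}\mu_H(H')\lambda_{H'}(J)$.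 -}

module Defs where

open import Data.Bool using (Bool; true; false; T)
open import Data.Nat using (ℕ; zero; suc; _+_; _≤_)
open import Data.Fin using (Fin; _<_) renaming (zero to fz; suc to fs)
open import Data.Fin.Properties using (any?; all?; _≟_; _<?_)
open import Data.Integer using (ℤ; +_; -_) renaming (_+_ to _+ℤ_; _*_ to _*ℤ_)
open import Data.List using (List; []; _∷_; map; concatMap; mapMaybe; filter; length; foldr; allFin; deduplicate; upTo)
open import Data.List.Relation.Unary.Any using (Any) renaming (any? to anyL?)
open import Data.Maybe using (Maybe; just; nothing)
open import Data.Product using (Σ; ∃; _×_; _,_)
open import Data.Sum using (_⊎_)
open import Relation.Binary.PropositionalEquality using (_≡_; _≢_)
open import Relation.Nullary using (Dec; yes; no; ¬_; ¬?)
open import Relation.Nullary.Decidable using (T?; _→-dec_; _×-dec_; _⊎-dec_)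

record Graph : Set where
  constructor mkGraph
  field
    n   : ℕ
    adj : Fin n → Fin n → Bool
    sym : ∀ u v → adj u v ≡ adj v u
open Graph public

NonEmpty : Graph → Set
NonEmpty G = 1 ≤ n G

Irreflexive : Graph → Set
Irreflexive G = ∀ v → adj G v v ≡ false

Reach : (G : Graph) → ℕ → Fin (n G) → Fin (n G) → Set
Reach G zero    u v = u ≡ v
Reach G (suc k) u v = u ≡ v ⊎ ∃ λ w → T (adj G u w) × Reach G k w v

-- connected: every two vertices are joined by a walk
-- (walks of length ≤ |V(G)| suffice, so this bound is no restriction)
Connected : Graph → Set
Connected G = ∀ u v → Reach G (n G) u v

reach? : (G : Graph) → ∀ k u v → Dec (Reach G k u v)
reach? G zero    u v = u ≟ v
reach? G (suc k) u v = (u ≟ v) ⊎-dec any? (λ w → T? (adj G u w) ×-dec reach? G k w v)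

connected? : (G : Graph) → Dec (Connected G)
connected? G = all? λ u → all? λ v → reach? G (n G) u v

allFunsL : {A : Set} → List A → (k : ℕ) → List (Fin k → A)
allFunsL xs zero    = (λ ()) ∷ []
allFunsL xs (suc k) =
  concatMap (λ a → map (λ f → λ { fz → a ; (fs i) → f i }) (allFunsL xs k)) xs

allFuns : (k m : ℕ) → List (Fin k → Fin m)
allFuns k m = allFunsL (allFin m) k

IsHom : (G H : Graph) → (Fin (n G) → Fin (n H)) → Set
IsHom G H h = ∀ u v → T (adj G u v) → T (adj H (h u) (h v))

isHom? : (G H : Graph) → ∀ h → Dec (IsHom G H h)
isHom? G H h = all? λ u → all? λ v → T? (adj G u v) →-dec T? (adj H (h u) (h v))

IsCompaction : (G H : Graph) → (Fin (n G) → Fin (n H)) → Set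
IsCompaction G H h =
  IsHom G H h
  × (∀ w → ∃ λ u → h u ≡ w)
  × (∀ w₁ w₂ → w₁ ≢ w₂ → T (adj H w₁ w₂) →
       ∃ λ u₁ → ∃ λ u₂ → T (adj G u₁ u₂) × h u₁ ≡ w₁ × h u₂ ≡ w₂)

isCompaction? : (G H : Graph) → ∀ h → Dec (IsCompaction G H h)
isCompaction? G H h =
  isHom? G H h
  ×-dec (all? λ w → any? λ u → h u ≟ w)
  ×-dec (all? λ w₁ → all? λ w₂ → ¬? (w₁ ≟ w₂) →-dec (T? (adj H w₁ w₂) →-dec
           (any? λ u₁ → any? λ u₂ → T? (adj G u₁ u₂) ×-dec (h u₁ ≟ w₁) ×-dec (h u₂ ≟ w₂))))

hom : Graph → Graph → ℕ
hom G H = length (filter (isHom? G H) (allFuns (n G) (n H)))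

comp : Graph → Graph → ℕ
comp G H = length (filter (isCompaction? G H) (allFuns (n G) (n H)))

IsIsoMap : (G H : Graph) → (Fin (n G) → Fin (n H)) → Set
IsIsoMap G H f =
  (∀ u v → f u ≡ f v → u ≡ v)
  × (∀ w → ∃ λ u → f u ≡ w)
  × (∀ u v → adj G u v ≡ adj H (f u) (f v))

isIsoMap? : (G H : Graph) → ∀ f → Dec (IsIsoMap G H f)
isIsoMap? G H f =
  (all? λ u → all? λ v → (f u ≟ f v) →-dec (u ≟ v))
  ×-dec (all? λ w → any? λ u → f u ≟ w)
  ×-dec (all? λ u → all? λ v → adj G u v Data.Bool.≟ adj H (f u) (f v))

_≅_ : Graph → Graph → Set
G ≅ H = Any (IsIsoMap G H) (allFuns (n G) (n H))

_≅?_ : (G H : Graph) → Dec (G ≅ H)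
G ≅? H = anyL? (isIsoMap? G H) (allFuns (n G) (n H))

-- Sub(H): non-empty, loop-hereditary, connected subgraphs of H.
-- A subgraph with k vertices is encoded uniquely by a strictly increasing
-- map ι : Fin k → V(H) (its vertex set is the image of ι) together with a
-- symmetric adjacency A on Fin k (its edge set is the image of A under ι),
-- with every edge of A an edge of H.  The list Sub H contains each such
-- subgraph exactly once, given as a graph on Fin k.

StrictlyIncreasing : {k m : ℕ} → (Fin k → Fin m) → Set
StrictlyIncreasing ι = ∀ i j → i < j → ι i < ι j

incr? : {k m : ℕ} → (ι : Fin k → Fin m) → Dec (StrictlyIncreasing ι)
incr? ι = all? λ i → all? λ j → (i <? j) →-dec (ι i <? ι j)

IsSubgraphVia : (H K : Graph) → (Fin (n K) → Fin (n H)) → Set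
IsSubgraphVia H K ι = ∀ u v → T (adj K u v) → T (adj H (ι u) (ι v))

LoopHereditaryVia : (H K : Graph) → (Fin (n K) → Fin (n H)) → Set
LoopHereditaryVia H K ι = ∀ u → T (adj H (ι u) (ι u)) → T (adj K u u)

candidate : (H : Graph) (k : ℕ) (ι : Fin k → Fin (n H)) (A : Fin k → Fin k → Bool) → Maybe Graph
candidate H k ι A with all? (λ u → all? λ v → A u v Data.Bool.≟ A v u)
... | no _  = nothing
... | yes s with (all? λ u → all? λ v → T? (A u v) →-dec T? (adj H (ι u) (ι v)))
                 ×-dec (all? λ u → T? (adj H (ι u) (ι u)) →-dec T? (A u u))
                 ×-dec connected? (mkGraph k A s)
...   | yes _ = just (mkGraph k A s)
...   | no _  = nothing

allAdj : (k : ℕ) → List (Fin k → Fin k → Bool)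
allAdj k = allFunsL (allFunsL (true ∷ false ∷ []) k) k

Sub : Graph → List Graph
Sub H = concatMap (λ k →
          concatMap (λ ι → mapMaybe (candidate H k ι) (allAdj k))
                    (filter incr? (allFuns k (n H))))
        (map suc (upTo (n H)))

𝒮 : Graph → List Graph
𝒮 H = deduplicate _≅?_ (Sub H)

μ : Graph → Graph → ℕ
μ H H' = length (filter (λ K → K ≅? H') (Sub H))

-- Every H' ∈ 𝒮_H with H' ≇ H is a proper
-- subgraph, hence has strictly smaller size (vertices + adjacent ordered
-- pairs); so fuel  suc (size H)  is always enough and the fuel-0 branch
-- is never reached.

sumℤ : List ℤ → ℤ
sumℤ = foldr _+ℤ_ (+ 0)

countTrue : {k : ℕ} → (Fin k → Bool) → ℕ
countTrue f = length (filter (λ i → T? (f i)) (allFin _))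

size : Graph → ℕ
size G = n G + foldr _+_ 0 (map (λ u → countTrue (adj G u)) (allFin (n G)))

λ-fuel : ℕ → Graph → Graph → ℤ
λ-fuel zero    H J = + 0
λ-fuel (suc f) H J with anyL? (λ H' → J ≅? H') (𝒮 H)
... | no _  = + 0
... | yes _ with J ≅? H
...   | yes _ = + 1
...   | no _  = - sumℤ (map (λ H' → (+ μ H H') *ℤ λ-fuel f H' J)
                            (filter (λ H' → ¬? (H' ≅? H)) (𝒮 H)))

λ[_] : Graph → Graph → ℤ
λ[ H ] J = λ-fuel (suc (size H)) H J

module Submission where

-- Every homomorphism G → H factors uniquely as a compaction of G onto a
-- member of Sub(H), namely its image (connected because G is), followed by
-- the inclusion.  Hence hom(G → H) = Σ_{K ∈ Sub H} comp(G → K), and grouping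
-- Sub(H) into isomorphism classes,
--   hom(G → H) = comp(G → H) + Σ_{H' ∈ 𝒮_H, H' ≇ H} μ_H(H') comp(G → H').
-- Each such H' is a proper subgraph of H, hence strictly smaller, so by
-- induction comp(G → H') = Σ_{J ∈ 𝒮_{H'}} λ_{H'}(J) hom(G → J).  Every member
-- of 𝒮_{H'} is isomorphic to exactly one member of 𝒮_H, so after collecting
-- the coefficient of each hom(G → J), J ∈ 𝒮_H, what remains is precisely the
-- recursion defining λ_H(J).

open import Algebra.Bundles using (CommutativeSemigroup)
open import Algebra.Structures using (IsCommutativeMonoid)
open import Data.Bool using (Bool; true; false; T)
import Data.Bool.Properties as Boolₚ
open import Data.Empty using (⊥-elim)
open import Data.Fin as Fin using (Fin; toℕ) renaming (zero to fz; suc to fs)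
open import Data.Fin.Properties
  using (_≟_; any?; all?; _<?_; toℕ<n; <-cmp; <-irrefl; <-asym; toℕ-injective; injective⇒≤)
open import Data.Integer as ℤ using (ℤ; +_; -_)
import Data.Integer.Properties as ℤₚ
open import Data.List using (List; []; _∷_; _++_; map; foldr; concatMap; mapMaybe; filter; length; allFin; upTo; lookup)
import Data.List.Properties as Listₚ
open import Data.List.Membership.Propositional using (_∈_; find; lose)
import Data.List.Membership.Propositional.Properties as ∈ₚ
open import Data.List.Relation.Unary.All as All using (All; []; _∷_)
import Data.List.Relation.Unary.All.Properties as Allₚ
open import Data.List.Relation.Unary.AllPairs using (AllPairs; []; _∷_)
open import Data.List.Relation.Unary.Any as Any using (Any; here; there; satisfied)
import Data.List.Relation.Unary.Any.Properties as Anyₚ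
open import Data.List.Relation.Unary.Unique.Propositional using (Unique)
import Data.List.Relation.Unary.Unique.DecSetoid.Properties as UniqueDSₚ
import Data.List.Relation.Unary.Unique.Propositional.Properties as Uniqueₚ
open import Data.Maybe using (Maybe; just; nothing; maybe′)
import Data.Maybe.Relation.Unary.Any as MaybeAny
open import Data.Nat as ℕ using (ℕ; zero; suc; z≤n; s≤s; _≤_; _<_)
import Data.Nat.Properties as ℕₚ
open import Data.Product using (Σ; ∃; _×_; _,_; proj₁; proj₂)
open import Data.Sum using (_⊎_; inj₁; inj₂)
open import Data.Vec.Functional using (Vector) renaming (_∷_ to _∷ᵛ_)
open import Data.Vec.Functional.Relation.Binary.Pointwise using (Pointwise)
import Data.Vec.Functional.Relation.Binary.Pointwise.Properties as Pointwiseₚ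
open import Function using (_∘_; id)
open import Function.Definitions using (Injective)
open import Level using (0ℓ)
open import Relation.Binary.Bundles using (DecSetoid)
open import Relation.Binary.Definitions using (tri<; tri≈; tri>)
open import Relation.Binary.PropositionalEquality
  using (_≡_; _≢_; refl; sym; trans; cong; cong₂; subst; subst₂; module ≡-Reasoning)
open import Relation.Nullary using (Dec; yes; no; ¬_; ¬?)
open import Relation.Nullary.Decidable using (T?; _×-dec_; _⊎-dec_; _→-dec_; ⌊_⌋; toWitness; fromWitness)
open import Defs renaming (sym to adj-sym)

count : {A : Set} {P : A → Set} → (∀ x → Dec (P x)) → List A → ℕ
count P? xs = length (filter P? xs)

module _ {A : Set} {P : A → Set} (P? : ∀ x → Dec (P x)) where

  count-none : (xs : List A) → ¬ Any P xs → count P? xs ≡ 0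
  count-none []       _    = refl
  count-none (x ∷ xs) ¬any with P? x
  ... | yes p = ⊥-elim (¬any (here p))
  ... | no _  = count-none xs (¬any ∘ there)

  count-unique : {R : A → A → Set} (xs : List A) → AllPairs (λ a b → ¬ R a b) xs →
                 (∀ {a b} → P a → P b → R a b) → Any P xs → count P? xs ≡ 1
  count-unique (x ∷ xs) (x-distinct ∷ distinct) P⇒R any with P? x | any
  ... | yes p | _        = cong suc (count-none xs
                             (Allₚ.All¬⇒¬Any (All.map (λ ¬r q → ¬r (P⇒R p q)) x-distinct)))
  ... | no ¬p | here p   = ⊥-elim (¬p p)
  ... | no _  | there ps = count-unique xs distinct P⇒R ps

  count≡1⇒Any : (xs : List A) → count P? xs ≡ 1 → Any P xs
  count≡1⇒Any (x ∷ xs) c with P? x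
  ... | yes p = here p
  ... | no _  = there (count≡1⇒Any xs c)

Enumerates : {A : Set} {_≈_ : A → A → Set} → (∀ x y → Dec (x ≈ y)) → List A → Set
Enumerates _≈?_ xs = ∀ a → count (_≈? a) xs ≡ 1

allFin-enumerates : ∀ n → Enumerates _≟_ (allFin n)
allFin-enumerates n a =
  count-unique (_≟ a) (allFin n) (Uniqueₚ.allFin⁺ n) (λ p q → trans p (sym q)) (Any.map sym (∈ₚ.∈-allFin a))

InImage : ∀ {k m} → (Fin k → Fin m) → Fin m → Set
InImage ι a = ∃ λ b → ι b ≡ a

inImage? : ∀ {k m} (ι : Fin k → Fin m) a → Dec (InImage ι a)
inImage? ι a = any? (λ b → ι b ≟ a)

module ListSum {C : Set} {_⊕_ : C → C → C} {ε : C}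
               (isCM : IsCommutativeMonoid _≡_ _⊕_ ε) where

  open IsCommutativeMonoid isCM using (assoc; identityˡ; identityʳ; isCommutativeSemigroup)

  private
    commutativeSemigroup : CommutativeSemigroup 0ℓ 0ℓ
    commutativeSemigroup = record { Carrier = C ; _≈_ = _≡_ ; _∙_ = _⊕_ ; isCommutativeSemigroup = isCommutativeSemigroup }

  open import Algebra.Properties.CommutativeSemigroup commutativeSemigroup using (interchange)

  ∑ : {A : Set} → List A → (A → C) → C
  ∑ xs f = foldr _⊕_ ε (map f xs)

  when : {P : Set} → Dec P → C → C
  when (yes _) c = c
  when (no _)  c = ε

  when-yes : {P : Set} (d : Dec P) (c : C) → P → when d c ≡ c
  when-yes (yes _) c p = refl
  when-yes (no ¬p) c p = ⊥-elim (¬p p)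

  when-no : {P : Set} (d : Dec P) (c : C) → ¬ P → when d c ≡ ε
  when-no (yes p) c ¬p = ⊥-elim (¬p p)
  when-no (no _)  c ¬p = refl

  when-⇔ : {P Q : Set} (d : Dec P) (e : Dec Q) (c : C) → (P → Q) → (Q → P) → when d c ≡ when e c
  when-⇔ (yes _) (yes _) c f g = refl
  when-⇔ (no _)  (no _)  c f g = refl
  when-⇔ (yes p) (no ¬q) c f g = ⊥-elim (¬q (f p))
  when-⇔ (no ¬p) (yes q) c f g = ⊥-elim (¬p (g q))

  when-congʳ : {P : Set} (d : Dec P) {x y : C} → (P → x ≡ y) → when d x ≡ when d y
  when-congʳ (yes p) e = e p
  when-congʳ (no _)  e = refl

  when-ε : {P : Set} (d : Dec P) (x : C) → (P → x ≡ ε) → when d x ≡ ε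
  when-ε (yes p) x x≡ε = x≡ε p
  when-ε (no _)  x x≡ε = refl

  when-≢ε : {P : Set} (d : Dec P) {x : C} → when d x ≢ ε → P
  when-≢ε (yes p) _   = p
  when-≢ε (no _)  ≢ε = ⊥-elim (≢ε refl)

  when-× : {P Q R : Set} (c : Dec R) (d : Dec P) (e : Dec Q) (x : C) → (R → P × Q) → (P × Q → R) →
           when c x ≡ when d (when e x)
  when-× c (yes p) (yes q) x f g = when-yes c x (g (p , q))
  when-× c (yes p) (no ¬q) x f g = when-no c x (λ r → ¬q (proj₂ (f r)))
  when-× c (no ¬p) e       x f g = when-no c x (λ r → ¬p (proj₁ (f r)))

  module _ {A : Set} where

    ∑-cong : (xs : List A) {f g : A → C} → (∀ x → f x ≡ g x) → ∑ xs f ≡ ∑ xs g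
    ∑-cong []       e = refl
    ∑-cong (x ∷ xs) e = cong₂ _⊕_ (e x) (∑-cong xs e)

    ∑-cong∈ : (xs : List A) {f g : A → C} → (∀ x → x ∈ xs → f x ≡ g x) → ∑ xs f ≡ ∑ xs g
    ∑-cong∈ []       e = refl
    ∑-cong∈ (x ∷ xs) e = cong₂ _⊕_ (e x (here refl)) (∑-cong∈ xs (λ y m → e y (there m)))

    ∑-ε∈ : (xs : List A) {f : A → C} → (∀ x → x ∈ xs → f x ≡ ε) → ∑ xs f ≡ ε
    ∑-ε∈ []       e = refl
    ∑-ε∈ (x ∷ xs) e = trans (cong₂ _⊕_ (e x (here refl)) (∑-ε∈ xs (λ y m → e y (there m)))) (identityˡ ε)

    ∑-ε : (xs : List A) {f : A → C} → (∀ x → f x ≡ ε) → ∑ xs f ≡ ε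
    ∑-ε xs e = ∑-ε∈ xs (λ x _ → e x)

    ∑-++ : (xs ys : List A) (f : A → C) → ∑ (xs ++ ys) f ≡ ∑ xs f ⊕ ∑ ys f
    ∑-++ []       ys f = sym (identityˡ _)
    ∑-++ (x ∷ xs) ys f = trans (cong (f x ⊕_) (∑-++ xs ys f)) (sym (assoc _ _ _))

    ∑-⊕ : (xs : List A) (f g : A → C) → ∑ xs (λ x → f x ⊕ g x) ≡ ∑ xs f ⊕ ∑ xs g
    ∑-⊕ []       f g = sym (identityˡ ε)
    ∑-⊕ (x ∷ xs) f g = trans (cong ((f x ⊕ g x) ⊕_) (∑-⊕ xs f g)) (interchange _ _ _ _)

    ∑-filter : {P : A → Set} (P? : ∀ x → Dec (P x)) (xs : List A) (f : A → C) →
               ∑ (filter P? xs) f ≡ ∑ xs (λ x → when (P? x) (f x))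
    ∑-filter P? []       f = refl
    ∑-filter P? (x ∷ xs) f with P? x
    ... | yes _ = cong (f x ⊕_) (∑-filter P? xs f)
    ... | no _  = trans (∑-filter P? xs f) (sym (identityˡ _))

    ∑-split : {P : A → Set} (P? : ∀ x → Dec (P x)) (xs : List A) (f : A → C) →
              ∑ xs f ≡ ∑ xs (λ x → when (P? x) (f x)) ⊕ ∑ (filter (¬? ∘ P?) xs) f
    ∑-split P? xs f =
      trans (∑-cong xs split)
        (trans (∑-⊕ xs _ _) (cong (∑ xs (λ x → when (P? x) (f x)) ⊕_) (sym (∑-filter (¬? ∘ P?) xs f))))
      where
      split : ∀ x → f x ≡ when (P? x) (f x) ⊕ when (¬? (P? x)) (f x)
      split x with P? x
      ... | yes _ = sym (identityʳ _)
      ... | no _  = sym (identityˡ _)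

    when-∑ : {P : Set} (d : Dec P) (xs : List A) (f : A → C) → when d (∑ xs f) ≡ ∑ xs (λ x → when d (f x))
    when-∑ (yes _) xs f = refl
    when-∑ (no _)  xs f = sym (∑-ε xs (λ _ → refl))

  module _ {A : Set} {P : A → Set} (P? : ∀ x → Dec (P x)) where

    ∑-when-none : (xs : List A) → count P? xs ≡ 0 → (f : A → C) → ∑ xs (λ x → when (P? x) (f x)) ≡ ε
    ∑-when-none []       _ f = refl
    ∑-when-none (x ∷ xs) c f with P? x
    ∑-when-none (x ∷ xs) () f | yes _
    ... | no _ = trans (identityˡ _) (∑-when-none xs c f)

    ∑-when-single : (xs : List A) → count P? xs ≡ 1 → (f : A → C) (c : C) → (∀ x → P x → f x ≡ c) →
                    ∑ xs (λ x → when (P? x) (f x)) ≡ c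
    ∑-when-single (x ∷ xs) k f c e with P? x
    ... | yes p = trans (cong₂ _⊕_ (e x p) (∑-when-none xs (cong ℕ.pred k) f)) (identityʳ c)
    ... | no _  = trans (identityˡ _) (∑-when-single xs k f c e)

    ∑-single : (xs : List A) → count P? xs ≡ 1 → (f : A → C) (c : C) →
               (∀ x → ¬ P x → f x ≡ ε) → (∀ x → P x → f x ≡ c) → ∑ xs f ≡ c
    ∑-single xs k f c z e =
      trans (∑-cong xs (λ x → sym (supported x))) (∑-when-single xs k f c e)
      where
      supported : ∀ x → when (P? x) (f x) ≡ f x
      supported x with P? x
      ... | yes _  = refl
      ... | no ¬p = sym (z x ¬p)

  module _ {A B : Set} where

    ∑-map : (g : A → B) (xs : List A) (f : B → C) → ∑ (map g xs) f ≡ ∑ xs (f ∘ g)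
    ∑-map g []       f = refl
    ∑-map g (x ∷ xs) f = cong (f (g x) ⊕_) (∑-map g xs f)

    ∑-concatMap : (g : A → List B) (xs : List A) (f : B → C) →
                  ∑ (concatMap g xs) f ≡ ∑ xs (λ x → ∑ (g x) f)
    ∑-concatMap g []       f = refl
    ∑-concatMap g (x ∷ xs) f = trans (∑-++ (g x) (concatMap g xs) f) (cong (∑ (g x) f ⊕_) (∑-concatMap g xs f))

    ∑-mapMaybe : (g : A → Maybe B) (xs : List A) (f : B → C) →
                 ∑ (mapMaybe g xs) f ≡ ∑ xs (λ x → maybe′ f ε (g x))
    ∑-mapMaybe g []       f = refl
    ∑-mapMaybe g (x ∷ xs) f with g x
    ... | just y  = cong (f y ⊕_) (∑-mapMaybe g xs f)
    ... | nothing = trans (∑-mapMaybe g xs f) (sym (identityˡ _))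

    ∑-swap : (xs : List A) (ys : List B) (f : A → B → C) →
             ∑ xs (λ x → ∑ ys (f x)) ≡ ∑ ys (λ y → ∑ xs (λ x → f x y))
    ∑-swap []       ys f = sym (∑-ε ys (λ _ → refl))
    ∑-swap (x ∷ xs) ys f =
      trans (cong (∑ ys (f x) ⊕_) (∑-swap xs ys f)) (sym (∑-⊕ ys (f x) (λ y → ∑ xs (λ x' → f x' y))))

  ∑-allFin-suc : ∀ n (f : Fin (suc n) → C) → ∑ (allFin (suc n)) f ≡ f fz ⊕ ∑ (allFin n) (f ∘ fs)
  ∑-allFin-suc n f = cong (f fz ⊕_) (trans (cong (λ xs → ∑ xs f) (sym (Listₚ.map-tabulate id fs))) (∑-map fs (allFin n) f))

  Congruent : {A : Set} {k : ℕ} → (Vector A k → C) → Set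
  Congruent F = ∀ g g' → Pointwise _≡_ g g' → F g ≡ F g'

  ∑-allFuns-zero : {A : Set} (xs : List A) (F : Vector A 0 → C) → Congruent F → ∀ g →
                   ∑ (allFunsL xs 0) F ≡ F g
  ∑-allFuns-zero xs F F-cong g = trans (identityʳ _) (F-cong _ _ (λ ()))

  ∑-allFuns-suc : {A : Set} (xs : List A) (k : ℕ) (F : Vector A (suc k) → C) → Congruent F →
                  ∑ (allFunsL xs (suc k)) F ≡ ∑ xs (λ a → ∑ (allFunsL xs k) (λ g → F (a ∷ᵛ g)))
  ∑-allFuns-suc xs k F F-cong =
    trans (∑-concatMap _ xs F)
      (∑-cong xs (λ a → trans (∑-map _ (allFunsL xs k) F)
        (∑-cong (allFunsL xs k) (λ g → F-cong _ _ (λ { fz → refl ; (fs i) → refl })))))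

  module _ {k m : ℕ} (ι : Fin k → Fin m) (ι-inj : Injective _≡_ _≡_ ι) where

    ∑-allFin-injection : (g : Fin m → C) → (∀ a → ¬ InImage ι a → g a ≡ ε) →
                         ∑ (allFin m) g ≡ ∑ (allFin k) (g ∘ ι)
    ∑-allFin-injection g g-outside =
      trans (∑-cong (allFin m) spread)
        (trans (∑-swap (allFin m) (allFin k) (λ a b → when (ι b ≟ a) (g a)))
          (∑-cong (allFin k) collect))
      where
      spread : ∀ a → g a ≡ ∑ (allFin k) (λ b → when (ι b ≟ a) (g a))
      spread a with inImage? ι a
      ... | no ∉ι = trans (g-outside a ∉ι) (sym (∑-ε (allFin k) (λ b → when-no (ι b ≟ a) _ (λ e → ∉ι (b , e)))))
      ... | yes (b₀ , ιb₀≡a) = sym (∑-single (_≟ b₀) (allFin k) (allFin-enumerates k b₀) _ (g a)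
              (λ b b≢b₀ → when-no (ι b ≟ a) _ (λ e → b≢b₀ (ι-inj (trans e (sym ιb₀≡a)))))
              (λ b b≡b₀ → when-yes (ι b ≟ a) _ (trans (cong ι b≡b₀) ιb₀≡a)))
      collect : ∀ b → ∑ (allFin m) (λ a → when (ι b ≟ a) (g a)) ≡ g (ι b)
      collect b = ∑-single (_≟ ι b) (allFin m) (allFin-enumerates m (ι b)) _ (g (ι b))
        (λ a a≢ιb → when-no (ι b ≟ a) _ (λ e → a≢ιb (sym e)))
        (λ a a≡ιb → trans (when-yes (ι b ≟ a) _ (sym a≡ιb)) (cong g a≡ιb))

    ∑-allFuns-injection : ∀ n (F : (Fin n → Fin m) → C) → Congruent F →
                          (∀ h u → ¬ InImage ι (h u) → F h ≡ ε) →
                          ∑ (allFuns n m) F ≡ ∑ (allFuns n k) (λ h → F (ι ∘ h))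
    ∑-allFuns-injection zero F F-cong F-outside =
      trans (∑-allFuns-zero (allFin m) F F-cong (ι ∘ none))
        (sym (∑-allFuns-zero (allFin k) (λ h → F (ι ∘ h)) (λ g g' _ → F-cong (ι ∘ g) (ι ∘ g') (λ ())) none))
      where
      none : Fin 0 → Fin k
      none ()
    ∑-allFuns-injection (suc n) F F-cong F-outside = begin
      ∑ (allFuns (suc n) m) F
        ≡⟨ ∑-allFuns-suc (allFin m) n F F-cong ⟩
      ∑ (allFin m) (λ a → ∑ (allFuns n m) (λ g → F (a ∷ᵛ g)))
        ≡⟨ ∑-allFin-injection _ (λ a ∉ι → ∑-ε (allFuns n m) (λ g → F-outside (a ∷ᵛ g) fz ∉ι)) ⟩
      ∑ (allFin k) (λ b → ∑ (allFuns n m) (λ g → F (ι b ∷ᵛ g)))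
        ≡⟨ ∑-cong (allFin k) (λ b → ∑-allFuns-injection n (λ g → F (ι b ∷ᵛ g))
             (λ g g' g≐g' → F-cong _ _ (λ { fz → refl ; (fs i) → g≐g' i }))
             (λ h u ∉ι → F-outside (ι b ∷ᵛ h) (fs u) ∉ι)) ⟩
      ∑ (allFin k) (λ b → ∑ (allFuns n k) (λ g → F (ι b ∷ᵛ (ι ∘ g))))
        ≡⟨ ∑-cong (allFin k) (λ b → ∑-cong (allFuns n k) (λ g → F-cong _ _ (λ { fz → refl ; (fs i) → refl }))) ⟩
      ∑ (allFin k) (λ b → ∑ (allFuns n k) (λ g → F (ι ∘ (b ∷ᵛ g))))
        ≡⟨ ∑-allFuns-suc (allFin k) n (λ h → F (ι ∘ h)) (λ g g' g≐g' → F-cong _ _ (cong ι ∘ g≐g')) ⟨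
      ∑ (allFuns (suc n) k) (λ h → F (ι ∘ h)) ∎
      where open ≡-Reasoning

  module _ (S : DecSetoid 0ℓ 0ℓ) where
    open DecSetoid S using (_≈_; setoid) renaming (Carrier to A; _≟_ to _≈?_; sym to ≈-sym; trans to ≈-trans)
    open import Data.List.Relation.Unary.Unique.Setoid setoid using () renaming (Unique to Distinct)

    ∑-representatives : (ys zs : List A) → Distinct ys → Distinct zs → (F : A → C) →
                        (∀ {a b} → a ≈ b → F a ≡ F b) → (∀ y → ¬ Any (y ≈_) zs → F y ≡ ε) →
                        (∀ z → z ∈ zs → Any (z ≈_) ys) → ∑ ys F ≡ ∑ zs F
    ∑-representatives ys zs ys-distinct zs-distinct F F-resp F-unmatched zs-covered =
      trans (∑-cong ys spread)
        (trans (∑-swap ys zs (λ y z → when (y ≈? z) (F y))) (∑-cong∈ zs collect))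
      where
      spread : ∀ y → F y ≡ ∑ zs (λ z → when (y ≈? z) (F y))
      spread y with Any.any? (y ≈?_) zs
      ... | yes match = sym (∑-when-single (y ≈?_) zs
              (count-unique (y ≈?_) zs zs-distinct (λ p q → ≈-trans (≈-sym p) q) match) _ (F y) (λ _ _ → refl))
      ... | no ¬match = trans (F-unmatched y ¬match)
              (sym (∑-ε zs (λ z → when-ε (y ≈? z) (F y) (λ _ → F-unmatched y ¬match))))
      collect : ∀ z → z ∈ zs → ∑ ys (λ y → when (y ≈? z) (F y)) ≡ F z
      collect z z∈zs = ∑-when-single (_≈? z) ys
        (count-unique (_≈? z) ys ys-distinct (λ p q → ≈-trans p (≈-sym q)) (Any.map ≈-sym (zs-covered z z∈zs)))
        F (F z) (λ y → F-resp)

open ListSum ℕₚ.+-0-isCommutativeMonoid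

count-∑ : {A : Set} {P : A → Set} (P? : ∀ x → Dec (P x)) (xs : List A) →
          count P? xs ≡ ∑ xs (λ x → when (P? x) 1)
count-∑ P? []       = refl
count-∑ P? (x ∷ xs) with P? x
... | yes _ = cong suc (count-∑ P? xs)
... | no _  = count-∑ P? xs

∑-when-const : {A : Set} {P : A → Set} (P? : ∀ x → Dec (P x)) (xs : List A) (c : ℕ) →
               ∑ xs (λ x → when (P? x) c) ≡ count P? xs ℕ.* c
∑-when-const P? []       c = refl
∑-when-const P? (x ∷ xs) c with P? x
... | yes _ = cong (c ℕ.+_) (∑-when-const P? xs c)
... | no _  = ∑-when-const P? xs c

∑-ones : ∀ k → ∑ (allFin k) (λ _ → 1) ≡ k
∑-ones zero    = refl
∑-ones (suc k) = trans (∑-allFin-suc k (λ _ → 1)) (cong suc (∑-ones k))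

allFunsL-enumerates : {A : Set} {_≈_ : A → A → Set} (_≈?_ : ∀ x y → Dec (x ≈ y)) (xs : List A) →
                      Enumerates _≈?_ xs → ∀ k → Enumerates (Pointwiseₚ.decidable _≈?_ {k}) (allFunsL xs k)
allFunsL-enumerates {_≈_ = _≈_} _≈?_ xs enum zero f =
  trans (count-∑ (_≐? f) (allFunsL xs 0))
    (trans (∑-allFuns-zero xs _ (λ g g' _ → when-⇔ (g ≐? f) (g' ≐? f) 1 (λ _ ()) (λ _ ())) f)
      (when-yes (f ≐? f) 1 (λ ())))
  where
  _≐?_ : (g g' : Vector _ 0) → Dec (Pointwise _≈_ g g')
  _≐?_ = Pointwiseₚ.decidable _≈?_
allFunsL-enumerates {_≈_ = _≈_} _≈?_ xs enum (suc k) f = begin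
  count (_≐? f) (allFunsL xs (suc k))
    ≡⟨ count-∑ (_≐? f) (allFunsL xs (suc k)) ⟩
  ∑ (allFunsL xs (suc k)) (λ g → when (g ≐? f) 1)
    ≡⟨ ∑-allFuns-suc xs k _ congruent ⟩
  ∑ xs (λ a → ∑ (allFunsL xs k) (λ g → when ((a ∷ᵛ g) ≐? f) 1))
    ≡⟨ ∑-cong xs (λ a → trans (∑-cong (allFunsL xs k) (split a)) (sym (when-∑ (a ≈? f fz) (allFunsL xs k) _))) ⟩
  ∑ xs (λ a → when (a ≈? f fz) (∑ (allFunsL xs k) (λ g → when (g ≐? (f ∘ fs)) 1)))
    ≡⟨ ∑-cong xs (λ a → cong (when (a ≈? f fz))
         (trans (sym (count-∑ (_≐? (f ∘ fs)) (allFunsL xs k))) (allFunsL-enumerates _≈?_ xs enum k (f ∘ fs)))) ⟩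
  ∑ xs (λ a → when (a ≈? f fz) 1)
    ≡⟨ sym (count-∑ (_≈? f fz) xs) ⟩
  count (_≈? f fz) xs
    ≡⟨ enum (f fz) ⟩
  1 ∎
  where
  open ≡-Reasoning
  _≐?_ : ∀ {k} (g g' : Vector _ k) → Dec (Pointwise _≈_ g g')
  _≐?_ = Pointwiseₚ.decidable _≈?_
  congruent : Congruent (λ g → when (g ≐? f) 1)
  congruent g g' e = when-⇔ (g ≐? f) (g' ≐? f) 1
    (λ p i → subst (_≈ f i) (e i) (p i)) (λ p i → subst (_≈ f i) (sym (e i)) (p i))
  split : ∀ a g → when ((a ∷ᵛ g) ≐? f) 1 ≡ when (a ≈? f fz) (when (g ≐? (f ∘ fs)) 1)
  split a g = when-× ((a ∷ᵛ g) ≐? f) (a ≈? f fz) (g ≐? (f ∘ fs)) 1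
    (λ p → p fz , p ∘ fs) (λ { (p , q) fz → p ; (p , q) (fs i) → q i })

allFuns-enumerates : ∀ k m → Enumerates (Pointwiseₚ.decidable _≟_) (allFuns k m)
allFuns-enumerates k m = allFunsL-enumerates _≟_ (allFin m) (allFin-enumerates m) k

allAdj-enumerates : ∀ k → Enumerates (Pointwiseₚ.decidable (Pointwiseₚ.decidable Boolₚ._≟_)) (allAdj k)
allAdj-enumerates k = allFunsL-enumerates _ _ (allFunsL-enumerates Boolₚ._≟_ _ bools k) k
  where
  bools : Enumerates Boolₚ._≟_ (true ∷ false ∷ [])
  bools true  = refl
  bools false = refl

+-tight : ∀ {a b c d} → a ≤ c → b ≤ d → a ℕ.+ b ≡ c ℕ.+ d → a ≡ c × b ≡ d
+-tight {a} {b} {c} {d} a≤c b≤d e = a≡c , ℕₚ.+-cancelˡ-≡ c b d (subst (λ z → z ℕ.+ b ≡ c ℕ.+ d) a≡c e)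
  where
  a≡c : a ≡ c
  a≡c = ℕₚ.≤-antisym a≤c (ℕₚ.+-cancelʳ-≤ d c a (subst (_≤ a ℕ.+ d) e (ℕₚ.+-monoʳ-≤ a b≤d)))

∑-mono-≤ : {A : Set} (xs : List A) {f g : A → ℕ} → (∀ x → f x ≤ g x) → ∑ xs f ≤ ∑ xs g
∑-mono-≤ []       f≤g = z≤n
∑-mono-≤ (x ∷ xs) f≤g = ℕₚ.+-mono-≤ (f≤g x) (∑-mono-≤ xs f≤g)

∑-tight : {A : Set} (xs : List A) {f g : A → ℕ} → (∀ x → f x ≤ g x) → ∑ xs f ≡ ∑ xs g →
          ∀ x → x ∈ xs → f x ≡ g x
∑-tight (x ∷ xs) f≤g e .x (here refl) = proj₁ (+-tight (f≤g x) (∑-mono-≤ xs f≤g) e)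
∑-tight (x ∷ xs) f≤g e y  (there y∈) = ∑-tight xs f≤g (proj₂ (+-tight (f≤g x) (∑-mono-≤ xs f≤g) e)) y y∈

when-≤ : {P : Set} (d : Dec P) (x : ℕ) → when d x ≤ x
when-≤ (yes _) x = ℕₚ.≤-refl
when-≤ (no _)  x = z≤n

when-1⇒ : {P : Set} (d : Dec P) → when d 1 ≡ 1 → P
when-1⇒ (yes p) _ = p

T-extensional : ∀ a b → (T a → T b) → (T b → T a) → a ≡ b
T-extensional true  true  _ _ = refl
T-extensional false false _ _ = refl
T-extensional true  false f _ = ⊥-elim (f _)
T-extensional false true  _ g = ⊥-elim (g _)

indicator : Bool → ℕ
indicator b = when (T? b) 1

indicator-injective : ∀ a b → indicator a ≡ indicator b → a ≡ b
indicator-injective true  true  _ = refl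
indicator-injective false false _ = refl

indicator-mono : ∀ a b → (T a → T b) → indicator a ≤ indicator b
indicator-mono true  true  _ = ℕₚ.≤-refl
indicator-mono true  false f = ⊥-elim (f _)
indicator-mono false b     _ = z≤n

module _ {k m : ℕ} (ι : Fin k → Fin m) (ι-inj : Injective _≡_ _≡_ ι)
         (g' : Fin k → ℕ) (g : Fin m → ℕ) (g'≤g∘ι : ∀ b → g' b ≤ g (ι b)) where

  private
    ∑-image : ∑ (allFin m) (λ a → when (inImage? ι a) (g a)) ≡ ∑ (allFin k) (g ∘ ι)
    ∑-image = trans (∑-allFin-injection ι ι-inj _ (λ a ∉ι → when-no (inImage? ι a) _ ∉ι))
                (∑-cong (allFin k) (λ b → when-yes (inImage? ι (ι b)) _ (b , refl)))

    ∑g∘ι≤∑g : ∑ (allFin k) (g ∘ ι) ≤ ∑ (allFin m) g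
    ∑g∘ι≤∑g = subst (_≤ ∑ (allFin m) g) ∑-image (∑-mono-≤ (allFin m) (λ a → when-≤ (inImage? ι a) (g a)))

  ∑-injection-≤ : ∑ (allFin k) g' ≤ ∑ (allFin m) g
  ∑-injection-≤ = ℕₚ.≤-trans (∑-mono-≤ (allFin k) g'≤g∘ι) ∑g∘ι≤∑g

  ∑-injection-≡ : ∑ (allFin k) g' ≡ ∑ (allFin m) g →
                  (∀ b → g' b ≡ g (ι b)) × (∀ a → when (inImage? ι a) (g a) ≡ g a)
  ∑-injection-≡ e =
    (λ b → ∑-tight (allFin k) g'≤g∘ι e₁ b (∈ₚ.∈-allFin b)) ,
    (λ a → ∑-tight (allFin m) (λ a → when-≤ (inImage? ι a) (g a)) (trans ∑-image e₂) a (∈ₚ.∈-allFin a))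
    where
    e₁ : ∑ (allFin k) g' ≡ ∑ (allFin k) (g ∘ ι)
    e₁ = ℕₚ.≤-antisym (∑-mono-≤ (allFin k) g'≤g∘ι) (subst (∑ (allFin k) (g ∘ ι) ≤_) (sym e) ∑g∘ι≤∑g)
    e₂ : ∑ (allFin k) (g ∘ ι) ≡ ∑ (allFin m) g
    e₂ = ℕₚ.≤-antisym ∑g∘ι≤∑g (ℕₚ.≤-reflexive (trans (sym e) e₁))

record _≃_ (G H : Graph) : Set where
  field
    to      : Fin (n G) → Fin (n H)
    from    : Fin (n H) → Fin (n G)
    from∘to : ∀ u → from (to u) ≡ u
    to∘from : ∀ w → to (from w) ≡ w
    adj-to  : ∀ u v → adj G u v ≡ adj H (to u) (to v)

  to-injective : Injective _≡_ _≡_ to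
  to-injective {u} {v} e = trans (sym (from∘to u)) (trans (cong from e) (from∘to v))

  adj-from : ∀ w w' → adj H w w' ≡ adj G (from w) (from w')
  adj-from w w' = sym (trans (adj-to (from w) (from w')) (cong₂ (adj H) (to∘from w) (to∘from w')))
open _≃_ public

≃-refl : ∀ {G} → G ≃ G
≃-refl = record { to = id ; from = id ; from∘to = λ _ → refl ; to∘from = λ _ → refl ; adj-to = λ _ _ → refl }

≃-sym : ∀ {G H} → G ≃ H → H ≃ G
≃-sym d = record { to = from d ; from = to d ; from∘to = to∘from d ; to∘from = from∘to d ; adj-to = adj-from d }

≃-trans : ∀ {G H K} → G ≃ H → H ≃ K → G ≃ K
≃-trans d e = record
  { to      = to e ∘ to d
  ; from    = from d ∘ from e
  ; from∘to = λ u → trans (cong (from d) (from∘to e (to d u))) (from∘to d u)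
  ; to∘from = λ w → trans (cong (to e) (to∘from d (from e w))) (to∘from e w)
  ; adj-to  = λ u v → trans (adj-to d u v) (adj-to e (to d u) (to d v))
  }

≃-vertices : ∀ {G H} → G ≃ H → n G ≡ n H
≃-vertices d = ℕₚ.≤-antisym (injective⇒≤ (to-injective d)) (injective⇒≤ (to-injective (≃-sym d)))

≃-same-adj : ∀ {k} (A A' : Fin k → Fin k → Bool) s s' → (∀ u v → A u v ≡ A' u v) →
             mkGraph k A s ≃ mkGraph k A' s'
≃-same-adj A A' s s' A≡A' =
  record { to = id ; from = id ; from∘to = λ _ → refl ; to∘from = λ _ → refl ; adj-to = A≡A' }

≅⇒≃ : ∀ {G H} → G ≅ H → G ≃ H
≅⇒≃ iso with satisfied iso
... | φ , (φ-inj , φ-surj , φ-adj) = record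
  { to      = φ
  ; from    = proj₁ ∘ φ-surj
  ; from∘to = λ u → φ-inj _ _ (proj₂ (φ-surj (φ u)))
  ; to∘from = proj₂ ∘ φ-surj
  ; adj-to  = φ-adj
  }

≃⇒≅ : ∀ {G H} → G ≃ H → G ≅ H
≃⇒≅ {G} {H} d =
  Any.map (λ φ≐to → respects (λ u → sym (φ≐to u)))
    (count≡1⇒Any (λ φ → Pointwiseₚ.decidable _≟_ φ (to d)) (allFuns (n G) (n H))
      (allFuns-enumerates (n G) (n H) (to d)))
  where
  respects : ∀ {φ} → (∀ u → to d u ≡ φ u) → IsIsoMap G H φ
  respects to≐φ =
    (λ u v e → to-injective d (trans (to≐φ u) (trans e (sym (to≐φ v))))) ,
    (λ w → from d w , trans (sym (to≐φ (from d w))) (to∘from d w)) ,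
    (λ u v → trans (adj-to d u v) (cong₂ (adj H) (to≐φ u) (to≐φ v)))

≅-refl : ∀ {G} → G ≅ G
≅-refl {G} = ≃⇒≅ {G} {G} ≃-refl

≅-sym : ∀ {G H} → G ≅ H → H ≅ G
≅-sym {G} {H} iso = ≃⇒≅ {H} {G} (≃-sym (≅⇒≃ {G} {H} iso))

≅-trans : ∀ {G H K} → G ≅ H → H ≅ K → G ≅ K
≅-trans {G} {H} {K} iso iso' = ≃⇒≅ {G} {K} (≃-trans (≅⇒≃ {G} {H} iso) (≅⇒≃ {H} {K} iso'))

≅-decSetoid : DecSetoid 0ℓ 0ℓ
≅-decSetoid = record
  { Carrier          = Graph
  ; _≈_              = _≅_
  ; isDecEquivalence = record
    { isEquivalence = record
      { refl  = λ {G} → ≅-refl {G}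
      ; sym   = λ {G} {H} → ≅-sym {G} {H}
      ; trans = λ {G} {H} {K} → ≅-trans {G} {H} {K}
      }
    ; _≟_ = _≅?_
    }
  }

IsHom-resp : ∀ {G K} h h' → (∀ u → h u ≡ h' u) → IsHom G K h → IsHom G K h'
IsHom-resp {K = K} h h' h≐h' hom u v a = subst T (cong₂ (adj K) (h≐h' u) (h≐h' v)) (hom u v a)

IsCompaction-resp : ∀ {G K} h h' → (∀ u → h u ≡ h' u) → IsCompaction G K h → IsCompaction G K h'
IsCompaction-resp {G} {K} h h' h≐h' (hom , onto-vertices , onto-edges) =
  IsHom-resp {G} {K} h h' h≐h' hom ,
  (λ w → let (u , e) = onto-vertices w in u , trans (sym (h≐h' u)) e) ,
  (λ w₁ w₂ w₁≢w₂ a → let (u₁ , u₂ , a' , e₁ , e₂) = onto-edges w₁ w₂ w₁≢w₂ a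
                    in u₁ , u₂ , a' , trans (sym (h≐h' u₁)) e₁ , trans (sym (h≐h' u₂)) e₂)

module _ {G K K' : Graph} (d : K ≃ K') where

  IsHom-≃ : ∀ h → IsHom G K h → IsHom G K' (to d ∘ h)
  IsHom-≃ h hom u v a = subst T (adj-to d (h u) (h v)) (hom u v a)

  IsCompaction-≃ : ∀ h → IsCompaction G K h → IsCompaction G K' (to d ∘ h)
  IsCompaction-≃ h (hom , onto-vertices , onto-edges) =
    IsHom-≃ h hom ,
    (λ w → let (u , e) = onto-vertices (from d w) in u , trans (cong (to d) e) (to∘from d w)) ,
    (λ w₁ w₂ w₁≢w₂ a →
      let (u₁ , u₂ , a' , e₁ , e₂) = onto-edges (from d w₁) (from d w₂)
                                       (λ e → w₁≢w₂ (trans (sym (to∘from d w₁)) (trans (cong (to d) e) (to∘from d w₂))))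
                                       (subst T (adj-from d w₁ w₂) a)
      in u₁ , u₂ , a' , trans (cong (to d) e₁) (to∘from d w₁) , trans (cong (to d) e₂) (to∘from d w₂))

  count-maps-≃ : {P : (Fin (n G) → Fin (n K)) → Set} {P' : (Fin (n G) → Fin (n K')) → Set}
    (P? : ∀ h → Dec (P h)) (P'? : ∀ h → Dec (P' h)) →
    (∀ h h' → (∀ u → h u ≡ h' u) → P' h → P' h') →
    (∀ h → P h → P' (to d ∘ h)) → (∀ h → P' (to d ∘ h) → P h) →
    count P? (allFuns (n G) (n K)) ≡ count P'? (allFuns (n G) (n K'))
  count-maps-≃ P? P'? P'-resp P⇒P' P'⇒P = begin
    count P? (allFuns (n G) (n K))
      ≡⟨ count-∑ P? (allFuns (n G) (n K)) ⟩
    ∑ (allFuns (n G) (n K)) (λ h → when (P? h) 1)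
      ≡⟨ ∑-cong (allFuns (n G) (n K)) (λ h → when-⇔ (P? h) (P'? _) 1 (P⇒P' h) (P'⇒P h)) ⟩
    ∑ (allFuns (n G) (n K)) (λ h → when (P'? (to d ∘ h)) 1)
      ≡⟨ ∑-allFuns-injection (to d) (to-injective d) (n G) _ congruent
           (λ h u ∉ → ⊥-elim (∉ (from d (h u) , to∘from d (h u)))) ⟨
    ∑ (allFuns (n G) (n K')) (λ h → when (P'? h) 1)
      ≡⟨ count-∑ P'? (allFuns (n G) (n K')) ⟨
    count P'? (allFuns (n G) (n K')) ∎
    where
    open ≡-Reasoning
    congruent : Congruent (λ h → when (P'? h) 1)
    congruent h h' e = when-⇔ (P'? h) (P'? h') 1 (P'-resp h h' e) (P'-resp h' h (λ u → sym (e u)))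

hom-≃ : ∀ G {J J'} → J ≃ J' → hom G J ≡ hom G J'
hom-≃ G {J} {J'} d = count-maps-≃ {G} d (isHom? G J) (isHom? G J') (IsHom-resp {G} {J'}) (IsHom-≃ {G} d)
  (λ h hom → IsHom-resp {G} {J} _ h (from∘to d ∘ h) (IsHom-≃ {G} (≃-sym d) _ hom))

comp-≃ : ∀ G {J J'} → J ≃ J' → comp G J ≡ comp G J'
comp-≃ G {J} {J'} d = count-maps-≃ {G} d (isCompaction? G J) (isCompaction? G J') (IsCompaction-resp {G} {J'})
  (IsCompaction-≃ {G} d) (λ h c → IsCompaction-resp {G} {J} _ h (from∘to d ∘ h) (IsCompaction-≃ {G} (≃-sym d) _ c))

degree : (G : Graph) → Fin (n G) → ℕ
degree G u = ∑ (allFin (n G)) (λ v → indicator (adj G u v))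

edges : Graph → ℕ
edges G = ∑ (allFin (n G)) (degree G)

size≡vertices+edges : ∀ G → size G ≡ n G ℕ.+ edges G
size≡vertices+edges G = cong (n G ℕ.+_) (∑-cong (allFin (n G)) (λ u → count-∑ (λ v → T? (adj G u v)) (allFin (n G))))

edges-≃ : ∀ {G H} → G ≃ H → edges H ≡ edges G
edges-≃ {G} {H} d =
  trans (∑-allFin-injection (to d) (to-injective d) _ onto)
    (∑-cong (allFin (n G)) (λ u →
      trans (∑-allFin-injection (to d) (to-injective d) _ onto)
        (∑-cong (allFin (n G)) (λ v → cong indicator (sym (adj-to d u v))))))
  where
  onto : ∀ {f : Fin (n H) → ℕ} w → ¬ InImage (to d) w → f w ≡ 0
  onto w ∉ = ⊥-elim (∉ (from d w , to∘from d w))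

size-≃ : ∀ {G H} → G ≃ H → size G ≡ size H
size-≃ {G} {H} d = begin
  size G                ≡⟨ size≡vertices+edges G ⟩
  n G ℕ.+ edges G       ≡⟨ cong₂ ℕ._+_ (≃-vertices d) (sym (edges-≃ d)) ⟩
  n H ℕ.+ edges H       ≡⟨ size≡vertices+edges H ⟨
  size H                ∎
  where open ≡-Reasoning

module _ {k m : ℕ} {ι : Fin k → Fin m} (ι-increasing : StrictlyIncreasing ι) where

  increasing⇒injective : Injective _≡_ _≡_ ι
  increasing⇒injective {x} {y} e with <-cmp x y
  ... | tri< x<y _ _ = ⊥-elim (<-irrefl e (ι-increasing x y x<y))
  ... | tri≈ _ x≡y _ = x≡y
  ... | tri> _ _ y<x = ⊥-elim (<-irrefl (sym e) (ι-increasing y x y<x))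

  increasing-reflects-< : ∀ x y → ι x Fin.< ι y → x Fin.< y
  increasing-reflects-< x y ιx<ιy with <-cmp x y
  ... | tri< x<y _ _    = x<y
  ... | tri≈ _ refl _   = ⊥-elim (<-irrefl refl ιx<ιy)
  ... | tri> _ _ y<x    = ⊥-elim (<-asym ιx<ιy (ι-increasing y x y<x))

count-below : ∀ k (i : Fin k) → ∑ (allFin k) (λ b → when (b <? i) 1) ≡ toℕ i
count-below (suc k) fz = trans (∑-allFin-suc k (λ b → when (b <? fz {k}) 1))
  (cong₂ ℕ._+_ (when-no (fz {k} <? fz {k}) 1 (λ ())) (∑-ε (allFin k) (λ b → when-no (fs b <? fz {k}) 1 (λ ()))))
count-below (suc k) (fs i) = trans (∑-allFin-suc k (λ b → when (b <? fs i) 1))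
  (cong₂ ℕ._+_ (when-yes (fz {k} <? fs i) 1 (s≤s z≤n))
    (trans (∑-cong (allFin k) (λ b → when-⇔ (fs b <? fs i) (b <? i) 1 (λ { (s≤s b<i) → b<i }) s≤s))
      (count-below k i)))

image-size : ∀ {k m} (ι : Fin k → Fin m) → Injective _≡_ _≡_ ι →
             ∑ (allFin m) (λ a → when (inImage? ι a) 1) ≡ k
image-size {k} ι ι-inj =
  trans (∑-allFin-injection ι ι-inj _ (λ a ∉ι → when-no (inImage? ι a) 1 ∉ι))
    (trans (∑-cong (allFin k) (λ b → when-yes (inImage? ι (ι b)) 1 (b , refl))) (∑-ones k))

SameImage : ∀ {k k' m} → (Fin k → Fin m) → (Fin k' → Fin m) → Set
SameImage ι ι' = ∀ a → (InImage ι a → InImage ι' a) × (InImage ι' a → InImage ι a)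

private
  same-indicator : ∀ {k k' m} {ι : Fin k → Fin m} {ι' : Fin k' → Fin m} → SameImage ι ι' →
                   (f : Fin m → ℕ) → ∀ a → when (inImage? ι a) (f a) ≡ when (inImage? ι' a) (f a)
  same-indicator {ι = ι} {ι'} same f a = when-⇔ (inImage? ι a) (inImage? ι' a) (f a) (proj₁ (same a)) (proj₂ (same a))

  rank : ∀ {k m} → (Fin k → Fin m) → Fin m → ℕ
  rank {m = m} ι c = ∑ (allFin m) (λ a → when (inImage? ι a) (when (a <? c) 1))

  rank-increasing : ∀ {k m} {ι : Fin k → Fin m} → StrictlyIncreasing ι → ∀ i → rank ι (ι i) ≡ toℕ i
  rank-increasing {k} {ι = ι} ι-increasing i =
    trans (∑-allFin-injection ι (increasing⇒injective ι-increasing) _ (λ a ∉ι → when-no (inImage? ι a) _ ∉ι))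
      (trans (∑-cong (allFin k) (λ b → trans (when-yes (inImage? ι (ι b)) _ (b , refl))
               (when-⇔ (ι b <? ι i) (b <? i) 1 (increasing-reflects-< ι-increasing b i) (ι-increasing b i))))
        (count-below k i))

sameImage⇒same-size : ∀ {k k' m} {ι : Fin k → Fin m} {ι' : Fin k' → Fin m} →
  StrictlyIncreasing ι → StrictlyIncreasing ι' → SameImage ι ι' → k ≡ k'
sameImage⇒same-size {k} {k'} {m} {ι} {ι'} ι-increasing ι'-increasing same = begin
  k                                             ≡⟨ image-size ι (increasing⇒injective ι-increasing) ⟨
  ∑ (allFin m) (λ a → when (inImage? ι a) 1)    ≡⟨ ∑-cong (allFin m) (same-indicator same (λ _ → 1)) ⟩
  ∑ (allFin m) (λ a → when (inImage? ι' a) 1)   ≡⟨ image-size ι' (increasing⇒injective ι'-increasing) ⟩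
  k'                                            ∎
  where open ≡-Reasoning

-- ι i is the image point of rank i, and ranks depend on the image alone.
sameImage⇒≐ : ∀ {k m} {ι ι' : Fin k → Fin m} →
  StrictlyIncreasing ι → StrictlyIncreasing ι' → SameImage ι ι' → ∀ i → ι i ≡ ι' i
sameImage⇒≐ {m = m} {ι} {ι'} ι-increasing ι'-increasing same i =
  trans (sym ι'j≡ιi) (cong ι' (sym (toℕ-injective i≡j)))
  where
  open ≡-Reasoning
  j : Fin _
  j = proj₁ (proj₁ (same (ι i)) (i , refl))
  ι'j≡ιi : ι' j ≡ ι i
  ι'j≡ιi = proj₂ (proj₁ (same (ι i)) (i , refl))
  i≡j : toℕ i ≡ toℕ j
  i≡j = begin
    toℕ i          ≡⟨ rank-increasing ι-increasing i ⟨
    rank ι (ι i)   ≡⟨ ∑-cong (allFin m) (same-indicator same (λ a → when (a <? ι i) 1)) ⟩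
    rank ι' (ι i)  ≡⟨ cong (rank ι') (sym ι'j≡ιi) ⟩
    rank ι' (ι' j) ≡⟨ rank-increasing ι'-increasing j ⟩
    toℕ j          ∎

record IncreasingEnumeration (m : ℕ) (P : Fin m → Set) : Set where
  field
    k          : ℕ
    ι          : Fin k → Fin m
    increasing : StrictlyIncreasing ι
    image⊆P    : ∀ a → InImage ι a → P a
    P⊆image    : ∀ a → P a → InImage ι a

increasingEnumeration : ∀ m (P : Fin m → Set) → (∀ a → Dec (P a)) → IncreasingEnumeration m P
increasingEnumeration zero P P? =
  record { k = 0 ; ι = λ () ; increasing = λ () ; image⊆P = λ () ; P⊆image = λ () }
increasingEnumeration (suc m) P P? with increasingEnumeration m (P ∘ fs) (P? ∘ fs) | P? fz
... | e | yes P0 = record { k = suc k ; ι = ι' ; increasing = increasing' ; image⊆P = image⊆P' ; P⊆image = P⊆image' }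
  where
  open IncreasingEnumeration e
  ι' : Fin (suc k) → Fin (suc m)
  ι' fz     = fz
  ι' (fs i) = fs (ι i)
  increasing' : StrictlyIncreasing ι'
  increasing' fz     (fs j) _         = s≤s z≤n
  increasing' (fs i) (fs j) (s≤s i<j) = s≤s (increasing i j i<j)
  image⊆P' : ∀ a → InImage ι' a → P a
  image⊆P' .fz         (fz , refl)   = P0
  image⊆P' .(fs (ι b)) (fs b , refl) = image⊆P (ι b) (b , refl)
  P⊆image' : ∀ a → P a → InImage ι' a
  P⊆image' fz     _  = fz , refl
  P⊆image' (fs a) Pa = let (b , e) = P⊆image a Pa in fs b , cong fs e
... | e | no ¬P0 = record { k = k ; ι = fs ∘ ι ; increasing = λ i j i<j → s≤s (increasing i j i<j)
                          ; image⊆P = image⊆P' ; P⊆image = P⊆image' }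
  where
  open IncreasingEnumeration e
  image⊆P' : ∀ a → InImage (fs ∘ ι) a → P a
  image⊆P' .(fs (ι b)) (b , refl) = image⊆P (ι b) (b , refl)
  P⊆image' : ∀ a → P a → InImage (fs ∘ ι) a
  P⊆image' fz     P0 = ⊥-elim (¬P0 P0)
  P⊆image' (fs a) Pa = let (b , e) = P⊆image a Pa in b , cong fs e

unique⇒lookup-injective : {A : Set} (xs : List A) → Unique xs → Injective _≡_ _≡_ (lookup xs)
unique⇒lookup-injective (x ∷ xs) (x∉ ∷ xs-unique) {fz}   {fz}   e = refl
unique⇒lookup-injective (x ∷ xs) (x∉ ∷ xs-unique) {fz}   {fs j} e = ⊥-elim (All.lookup x∉ (∈ₚ.∈-lookup j) e)
unique⇒lookup-injective (x ∷ xs) (x∉ ∷ xs-unique) {fs i} {fz}   e = ⊥-elim (All.lookup x∉ (∈ₚ.∈-lookup i) (sym e))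
unique⇒lookup-injective (x ∷ xs) (x∉ ∷ xs-unique) {fs i} {fs j} e = cong fs (unique⇒lookup-injective xs xs-unique e)

module _ (G : Graph) where

  data Walk : Fin (n G) → Fin (n G) → ℕ → Set where
    stay : ∀ {u} → Walk u u 0
    step : ∀ {u w v l} → T (adj G u w) → Walk w v l → Walk u v (suc l)

  vertices : ∀ {u v l} → Walk u v l → List (Fin (n G))
  vertices {u} stay       = u ∷ []
  vertices {u} (step _ W) = u ∷ vertices W

  length-vertices : ∀ {u v l} (W : Walk u v l) → length (vertices W) ≡ suc l
  length-vertices stay       = refl
  length-vertices (step _ W) = cong suc (length-vertices W)

  Reach⇒Walk : ∀ j {u v} → Reach G j u v → ∃ λ l → l ≤ j × Walk u v l
  Reach⇒Walk zero    refl                = 0 , z≤n , stay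
  Reach⇒Walk (suc j) (inj₁ refl)         = 0 , z≤n , stay
  Reach⇒Walk (suc j) (inj₂ (w , a , r)) = let (l , l≤j , W) = Reach⇒Walk j r in suc l , s≤s l≤j , step a W

  Walk⇒Reach : ∀ j {u v l} → Walk u v l → l ≤ j → Reach G j u v
  Walk⇒Reach zero    stay       _         = refl
  Walk⇒Reach (suc j) stay       _         = inj₁ refl
  Walk⇒Reach (suc j) (step a W) (s≤s l≤j) = inj₂ (_ , a , Walk⇒Reach j W l≤j)

  PathWithin : Fin (n G) → Fin (n G) → ℕ → Set
  PathWithin u v l = ∃ λ l' → l' ≤ l × Σ (Walk u v l') (Unique ∘ vertices)

  private
    suffix : ∀ {u w v l} (W : Walk w v l) → Unique (vertices W) → u ∈ vertices W → PathWithin u v l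
    suffix stay       _             (here refl) = 0 , z≤n , stay , [] ∷ []
    suffix (step a W) unique        (here refl) = _ , ℕₚ.≤-refl , step a W , unique
    suffix (step a W) (_ ∷ unique) (there u∈)  =
      let (l' , l'≤l , P , P-unique) = suffix W unique u∈ in l' , ℕₚ.m≤n⇒m≤1+n l'≤l , P , P-unique

  -- If the start vertex reappears further on, cut out the closed walk it begins.
  walk⇒path : ∀ {u v l} (W : Walk u v l) → PathWithin u v l
  walk⇒path stay = 0 , z≤n , stay , [] ∷ []
  walk⇒path {u} (step a W) with walk⇒path W
  ... | (l' , l'≤l , P , P-unique) with Any.any? (u ≟_) (vertices P)
  ...   | yes u∈ = let (l'' , l''≤l' , P' , P'-unique) = suffix P P-unique u∈
                   in l'' , ℕₚ.m≤n⇒m≤1+n (ℕₚ.≤-trans l''≤l' l'≤l) , P' , P'-unique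
  ...   | no u∉  = suc l' , s≤s l'≤l , step a P , Allₚ.¬Any⇒All¬ (vertices P) u∉ ∷ P-unique

  reach-within-order : ∀ j {u v} → Reach G j u v → Reach G (n G) u v
  reach-within-order j r =
    let (l , _ , W) = Reach⇒Walk j r
        (l' , _ , P , P-unique) = walk⇒path W
        l'<n : suc l' ≤ n G
        l'<n = subst (_≤ n G) (length-vertices P) (injective⇒≤ (unique⇒lookup-injective (vertices P) P-unique))
    in Walk⇒Reach (n G) P (ℕₚ.≤-trans (ℕₚ.n≤1+n l') l'<n)

Reach-hom : ∀ {G G'} (φ : Fin (n G) → Fin (n G')) → IsHom G G' φ → ∀ j {u v} → Reach G j u v → Reach G' j (φ u) (φ v)
Reach-hom φ φ-hom zero    e                  = cong φ e
Reach-hom φ φ-hom (suc j) (inj₁ e)           = inj₁ (cong φ e)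
Reach-hom φ φ-hom (suc j) (inj₂ (w , a , r)) = inj₂ (φ w , φ-hom _ _ a , Reach-hom φ φ-hom j r)

Connected-onto : ∀ {G G'} (φ : Fin (n G) → Fin (n G')) → IsHom G G' φ → (∀ w → InImage φ w) →
                 Connected G → Connected G'
Connected-onto {G} {G'} φ φ-hom φ-onto G-connected u' v' =
  let (u , φu≡u') = φ-onto u' ; (v , φv≡v') = φ-onto v'
  in reach-within-order G' (n G) (subst₂ (Reach G' (n G)) φu≡u' φv≡v' (Reach-hom φ φ-hom (n G) (G-connected u v)))

SubConditions : (H K : Graph) → (Fin (n K) → Fin (n H)) → Set
SubConditions H K ι = IsSubgraphVia H K ι × LoopHereditaryVia H K ι × Connected K

data CandidateView (H : Graph) (k : ℕ) (ι : Fin k → Fin (n H)) (A : Fin k → Fin k → Bool) : Maybe Graph → Set where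
  rejected : (∀ s → ¬ SubConditions H (mkGraph k A s) ι) → CandidateView H k ι A nothing
  accepted : ∀ s → SubConditions H (mkGraph k A s) ι → CandidateView H k ι A (just (mkGraph k A s))

candidate-view : ∀ H k ι A → CandidateView H k ι A (candidate H k ι A)
candidate-view H k ι A with all? (λ u → all? λ v → A u v Boolₚ.≟ A v u)
... | no ¬s = rejected (λ s _ → ¬s s)
... | yes s with (all? λ u → all? λ v → T? (A u v) →-dec T? (adj H (ι u) (ι v)))
                 ×-dec (all? λ u → T? (adj H (ι u) (ι u)) →-dec T? (A u u))
                 ×-dec connected? (mkGraph k A s)
...   | yes c  = accepted s c
...   | no ¬c = rejected (λ s' (sub , loops , conn) →
                  ¬c (sub , loops , (λ u v → Reach-hom {mkGraph k A s'} {mkGraph k A s} id (λ _ _ a → a) k (conn u v))))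

SubConditions-cong : ∀ H {k} {ι ι' : Fin k → Fin (n H)} {A A' : Fin k → Fin k → Bool} s s' →
  (∀ i → ι' i ≡ ι i) → (∀ u v → A' u v ≡ A u v) →
  SubConditions H (mkGraph k A s) ι → SubConditions H (mkGraph k A' s') ι'
SubConditions-cong H {k} {A = A} {A'} s s' ι'≐ι A'≐A (sub , loops , conn) =
  (λ u v a → subst T (sym (cong₂ (adj H) (ι'≐ι u) (ι'≐ι v))) (sub u v (subst T (A'≐A u v) a))) ,
  (λ u l → subst T (sym (A'≐A u u)) (loops u (subst T (cong₂ (adj H) (ι'≐ι u) (ι'≐ι u)) l))) ,
  (λ u v → Reach-hom {mkGraph k A s} {mkGraph k A' s'} id (λ a b t → subst T (sym (A'≐A a b)) t) k (conn u v))

record Embedding (H K : Graph) : Set where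
  field
    ι               : Fin (n K) → Fin (n H)
    increasing      : StrictlyIncreasing ι
    subgraph        : IsSubgraphVia H K ι
    loop-hereditary : LoopHereditaryVia H K ι

record SubMember (H K : Graph) : Set where
  field
    embedding : Embedding H K
    connected : Connected K
    nonempty  : NonEmpty K

sizes : ℕ → List ℕ
sizes N = map suc (upTo N)

∈-sizes : ∀ {N k} → 1 ≤ k → k ≤ N → k ∈ sizes N
∈-sizes {k = suc i} _ k≤N = ∈ₚ.∈-map⁺ suc (∈ₚ.∈-upTo⁺ k≤N)

count-sizes : ∀ N k → 1 ≤ k → k ≤ N → count (ℕₚ._≟ k) (sizes N) ≡ 1
count-sizes N k 1≤k k≤N =
  count-unique (ℕₚ._≟ k) (sizes N) (Uniqueₚ.map⁺ ℕₚ.suc-injective (Uniqueₚ.upTo⁺ N))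
    (λ p q → trans p (sym q)) (Any.map sym (∈-sizes 1≤k k≤N))

candidate-accepts : ∀ H {k} {ι : Fin k → Fin (n H)} {A} s → SubConditions H (mkGraph k A s) ι →
                    ∃ λ s' → candidate H k ι A ≡ just (mkGraph k A s')
candidate-accepts H {k} {ι} {A} s conds with candidate H k ι A | candidate-view H k ι A
... | .nothing | rejected ¬c   = ⊥-elim (¬c s conds)
... | .(just _) | accepted s' _ = s' , refl

∈-mapMaybe⁻ : {A B : Set} (g : A → Maybe B) (xs : List A) {y : B} → y ∈ mapMaybe g xs →
              ∃ λ x → x ∈ xs × g x ≡ just y
∈-mapMaybe⁻ g (x ∷ xs) y∈ with g x in gx≡
∈-mapMaybe⁻ g (x ∷ xs) (here refl) | just y = x , here refl , gx≡
∈-mapMaybe⁻ g (x ∷ xs) (there y∈)  | just y = let (x' , x'∈ , e) = ∈-mapMaybe⁻ g xs y∈ in x' , there x'∈ , e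
∈-mapMaybe⁻ g (x ∷ xs) y∈          | nothing = let (x' , x'∈ , e) = ∈-mapMaybe⁻ g xs y∈ in x' , there x'∈ , e

∈Sub⇒SubMember : ∀ H {K} → K ∈ Sub H → SubMember H K
∈Sub⇒SubMember H {K} K∈ =
  let (k , k∈ , K∈k) = find (∈ₚ.∈-concatMap⁻ (λ k → concatMap (λ ι → mapMaybe (candidate H k ι) (allAdj k))
                                                  (filter incr? (allFuns k (n H)))) {xs = sizes (n H)} K∈)
      (i , _ , k≡1+i) = ∈ₚ.∈-map⁻ suc k∈
      (ι , ι∈ , K∈ι) = find (∈ₚ.∈-concatMap⁻ (λ ι → mapMaybe (candidate H k ι) (allAdj k))
                                               {xs = filter incr? (allFuns k (n H))} K∈k)
      (_ , ι-increasing) = ∈ₚ.∈-filter⁻ incr? {xs = allFuns k (n H)} ι∈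
      (A , _ , candidate≡K) = ∈-mapMaybe⁻ (candidate H k ι) (allAdj k) K∈ι
  in accepted⇒SubMember k≡1+i ι-increasing (candidate-view H k ι A) candidate≡K
  where
  accepted⇒SubMember : ∀ {k i ι A m} → k ≡ suc i → StrictlyIncreasing ι → CandidateView H k ι A m → m ≡ just K →
                       SubMember H K
  accepted⇒SubMember refl ι-increasing (accepted s (sub , loops , conn)) refl = record
    { embedding = record { ι = _ ; increasing = ι-increasing ; subgraph = sub ; loop-hereditary = loops }
    ; connected = conn
    ; nonempty  = s≤s z≤n
    }

Sub-complete : ∀ H {k} (ι : Fin k → Fin (n H)) → StrictlyIncreasing ι → 1 ≤ k → k ≤ n H → ∀ A s →
               SubConditions H (mkGraph k A s) ι → Any (mkGraph k A s ≅_) (Sub H)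
Sub-complete H {k} ι ι-increasing 1≤k k≤n A s conds =
  Anyₚ.concatMap⁺ (λ k → concatMap (λ ι → mapMaybe (candidate H k ι) (allAdj k)) (filter incr? (allFuns k (n H))))
    (lose (∈-sizes 1≤k k≤n)
    (Anyₚ.concatMap⁺ (λ ι → mapMaybe (candidate H k ι) (allAdj k)) (lose (∈ₚ.∈-filter⁺ incr? ι'∈ ι'-increasing)
      (Anyₚ.mapMaybe⁺ (candidate H k ι') (allAdj k)
        (Anyₚ.map⁺ (lose A'∈ (subst (MaybeAny.Any (mkGraph k A s ≅_)) (sym candidate≡)
          (MaybeAny.just (≃⇒≅ {mkGraph k A s} {mkGraph k A' s''} (≃-same-adj A A' s s'' (λ u v → sym (A'≐A u v))))))))))))
  where
  ι'-found : ∃ λ ι' → ι' ∈ allFuns k (n H) × (∀ i → ι' i ≡ ι i)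
  ι'-found = find (count≡1⇒Any _ (allFuns k (n H)) (allFuns-enumerates k (n H) ι))
  ι' : Fin k → Fin (n H)
  ι' = proj₁ ι'-found
  ι'∈ : ι' ∈ allFuns k (n H)
  ι'∈ = proj₁ (proj₂ ι'-found)
  ι'≐ι : ∀ i → ι' i ≡ ι i
  ι'≐ι = proj₂ (proj₂ ι'-found)
  ι'-increasing : StrictlyIncreasing ι'
  ι'-increasing a b a<b = subst₂ Fin._<_ (sym (ι'≐ι a)) (sym (ι'≐ι b)) (ι-increasing a b a<b)
  A'-found : ∃ λ A' → A' ∈ allAdj k × (∀ u v → A' u v ≡ A u v)
  A'-found = find (count≡1⇒Any _ (allAdj k) (allAdj-enumerates k A))
  A' : Fin k → Fin k → Bool
  A' = proj₁ A'-found
  A'∈ : A' ∈ allAdj k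
  A'∈ = proj₁ (proj₂ A'-found)
  A'≐A : ∀ u v → A' u v ≡ A u v
  A'≐A = proj₂ (proj₂ A'-found)
  s' : ∀ u v → A' u v ≡ A' v u
  s' u v = trans (A'≐A u v) (trans (s u v) (sym (A'≐A v u)))
  accepts : ∃ λ s'' → candidate H k ι' A' ≡ just (mkGraph k A' s'')
  accepts = candidate-accepts H s' (SubConditions-cong H s s' ι'≐ι A'≐A conds)
  s'' : ∀ u v → A' u v ≡ A' v u
  s'' = proj₁ accepts
  candidate≡ : candidate H k ι' A' ≡ just (mkGraph k A' s'')
  candidate≡ = proj₂ accepts

Summand : Graph → Set
Summand H = ∀ k → (Fin k → Fin (n H)) → (Fin k → Fin k → Bool) → ℕ

∑-parameters : ∀ H → Summand H → ℕ
∑-parameters H S = ∑ (sizes (n H)) (λ k → ∑ (allFuns k (n H)) (λ ι → when (incr? ι) (∑ (allAdj k) (S k ι))))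

∑-Sub : ∀ H (F : Graph → ℕ) → ∑ (Sub H) F ≡ ∑-parameters H (λ k ι A → maybe′ F 0 (candidate H k ι A))
∑-Sub H F =
  trans (∑-concatMap _ (sizes (n H)) F)
    (∑-cong (sizes (n H)) (λ k → trans (∑-concatMap _ (filter incr? (allFuns k (n H))) F)
      (trans (∑-filter incr? (allFuns k (n H)) _)
        (∑-cong (allFuns k (n H)) (λ ι → cong (when (incr? ι)) (∑-mapMaybe (candidate H k ι) (allAdj k) F))))))

∑-parameters-cong : ∀ H (S S' : Summand H) →
  (∀ {k} (ι : Fin k → Fin (n H)) A → StrictlyIncreasing ι → S k ι A ≡ S' k ι A) → ∑-parameters H S ≡ ∑-parameters H S'
∑-parameters-cong H S S' S≡S' = ∑-cong (sizes (n H)) (λ k → ∑-cong (allFuns k (n H)) (λ ι →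
  when-congʳ (incr? ι) (λ ι-increasing → ∑-cong (allAdj k) (λ A → S≡S' ι A ι-increasing))))

∑-parameters-ε : ∀ H (S : Summand H) → (∀ {k} (ι : Fin k → Fin (n H)) A → StrictlyIncreasing ι → S k ι A ≡ 0) →
                 ∑-parameters H S ≡ 0
∑-parameters-ε H S S≡0 = ∑-ε (sizes (n H)) (λ k → ∑-ε (allFuns k (n H)) (λ ι →
  when-ε (incr? ι) _ (λ ι-increasing → ∑-ε (allAdj k) (λ A → S≡0 ι A ι-increasing))))

∑-parameters-swap : ∀ H {X : Set} (xs : List X) (S : X → Summand H) →
  ∑-parameters H (λ k ι A → ∑ xs (λ x → S x k ι A)) ≡ ∑ xs (λ x → ∑-parameters H (S x))
∑-parameters-swap H xs S =
  trans (∑-cong (sizes (n H)) (λ k →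
          trans (∑-cong (allFuns k (n H)) (λ ι →
                  trans (when-congʳ (incr? ι) (λ _ → ∑-swap (allAdj k) xs _)) (when-∑ (incr? ι) xs _)))
                (∑-swap (allFuns k (n H)) xs _)))
    (∑-swap (sizes (n H)) xs _)

vanishes : ∀ {x} {P : Set} → (x ≢ 0 → P) → ¬ P → x ≡ 0
vanishes {x} x≢0⇒P ¬P with x ℕₚ.≟ 0
... | yes x≡0 = x≡0
... | no x≢0  = ⊥-elim (¬P (x≢0⇒P x≢0))

∑-parameters-single : ∀ H (S : Summand H) →
  (∀ {k} {ι ι' : Fin k → Fin (n H)} {A A'} → (∀ i → ι i ≡ ι' i) → (∀ u v → A u v ≡ A' u v) → S k ι A ≡ S k ι' A') →
  ∀ {k₀} (ι₀ : Fin k₀ → Fin (n H)) A₀ → 1 ≤ k₀ → k₀ ≤ n H → StrictlyIncreasing ι₀ →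
  (∀ {k} (ι : Fin k → Fin (n H)) A → StrictlyIncreasing ι → S k ι A ≢ 0 → k ≡ k₀) →
  (∀ ι A → StrictlyIncreasing ι → S k₀ ι A ≢ 0 → ∀ i → ι i ≡ ι₀ i) →
  (∀ A → S k₀ ι₀ A ≢ 0 → ∀ u v → A u v ≡ A₀ u v) →
  ∑-parameters H S ≡ S k₀ ι₀ A₀
∑-parameters-single H S S-cong {k₀} ι₀ A₀ 1≤k₀ k₀≤n ι₀-increasing k-unique ι-unique A-unique = begin
  ∑-parameters H S
    ≡⟨ ∑-single (ℕₚ._≟ k₀) (sizes (n H)) (count-sizes (n H) k₀ 1≤k₀ k₀≤n) _ _ other-k (λ { _ refl → refl }) ⟩
  ∑ (allFuns k₀ (n H)) (λ ι → when (incr? ι) (∑ (allAdj k₀) (S k₀ ι)))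
    ≡⟨ ∑-single (λ ι → Pointwiseₚ.decidable _≟_ ι ι₀) (allFuns k₀ (n H)) (allFuns-enumerates k₀ (n H) ι₀)
         _ _ other-ι same-ι ⟩
  when (incr? ι₀) (∑ (allAdj k₀) (S k₀ ι₀))
    ≡⟨ when-yes (incr? ι₀) _ ι₀-increasing ⟩
  ∑ (allAdj k₀) (S k₀ ι₀)
    ≡⟨ ∑-single (λ A → Pointwiseₚ.decidable (Pointwiseₚ.decidable Boolₚ._≟_) A A₀) (allAdj k₀) (allAdj-enumerates k₀ A₀)
         _ _ (λ A A≢A₀ → vanishes (A-unique A) A≢A₀) (λ A A≐A₀ → S-cong (λ _ → refl) A≐A₀) ⟩
  S k₀ ι₀ A₀ ∎
  where
  open ≡-Reasoning
  other-k : ∀ k → k ≢ k₀ → ∑ (allFuns k (n H)) (λ ι → when (incr? ι) (∑ (allAdj k) (S k ι))) ≡ 0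
  other-k k k≢k₀ = ∑-ε (allFuns k (n H)) (λ ι → when-ε (incr? ι) _ (λ ι-increasing →
    ∑-ε (allAdj k) (λ A → vanishes (k-unique ι A ι-increasing) k≢k₀)))
  other-ι : ∀ ι → ¬ (∀ i → ι i ≡ ι₀ i) → when (incr? ι) (∑ (allAdj k₀) (S k₀ ι)) ≡ 0
  other-ι ι ι≢ι₀ = when-ε (incr? ι) _ (λ ι-increasing →
    ∑-ε (allAdj k₀) (λ A → vanishes (ι-unique ι A ι-increasing) ι≢ι₀))
  same-ι : ∀ ι → (∀ i → ι i ≡ ι₀ i) →
           when (incr? ι) (∑ (allAdj k₀) (S k₀ ι)) ≡ when (incr? ι₀) (∑ (allAdj k₀) (S k₀ ι₀))
  same-ι ι ι≐ι₀ =
    trans (when-congʳ (incr? ι) (λ _ → ∑-cong (allAdj k₀) (λ A → S-cong ι≐ι₀ (λ _ _ → refl))))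
      (when-⇔ (incr? ι) (incr? ι₀) _ (λ _ → ι₀-increasing)
        (λ _ a b a<b → subst₂ Fin._<_ (sym (ι≐ι₀ a)) (sym (ι≐ι₀ b)) (ι₀-increasing a b a<b)))

module _ (H : Graph) (F : Graph → ℕ) where

  candidate-≢0 : ∀ {k} {ι : Fin k → Fin (n H)} {A} → maybe′ F 0 (candidate H k ι A) ≢ 0 →
                 ∃ λ s → SubConditions H (mkGraph k A s) ι × F (mkGraph k A s) ≢ 0
  candidate-≢0 {k} {ι} {A} ≢0 with candidate H k ι A | candidate-view H k ι A
  ... | .nothing  | rejected _   = ⊥-elim (≢0 refl)
  ... | .(just _) | accepted s c = s , c , ≢0

  candidate-cong : (∀ {K K'} → K ≃ K' → F K ≡ F K') →
                   ∀ {k} {ι ι' : Fin k → Fin (n H)} {A A'} → (∀ i → ι i ≡ ι' i) → (∀ u v → A u v ≡ A' u v) →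
                   maybe′ F 0 (candidate H k ι A) ≡ maybe′ F 0 (candidate H k ι' A')
  candidate-cong F-resp {k} {ι} {ι'} {A} {A'} ι≐ι' A≐A' = go (candidate-view H k ι A) (candidate-view H k ι' A')
    where
    go : ∀ {m m'} → CandidateView H k ι A m → CandidateView H k ι' A' m' → maybe′ F 0 m ≡ maybe′ F 0 m'
    go (rejected _)   (rejected _)    = refl
    go (accepted s _) (accepted s' _) = F-resp (≃-same-adj A A' s s' A≐A')
    go (rejected ¬c)  (accepted s' c) = ⊥-elim (¬c s (SubConditions-cong H s' s ι≐ι' A≐A' c))
      where s = λ u v → trans (A≐A' u v) (trans (s' u v) (sym (A≐A' v u)))
    go (accepted s c) (rejected ¬c)   = ⊥-elim (¬c s' (SubConditions-cong H s s' (sym ∘ ι≐ι') (λ u v → sym (A≐A' u v)) c))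
      where s' = λ u v → trans (sym (A≐A' u v)) (trans (s u v) (A≐A' v u))

module _ {H K : Graph} (E : Embedding H K) where
  open Embedding E

  private
    ι-injective : Injective _≡_ _≡_ ι
    ι-injective = increasing⇒injective increasing

    degree-along-ι : Fin (n K) → ℕ
    degree-along-ι u = ∑ (allFin (n K)) (λ v → indicator (adj H (ι u) (ι v)))

    degree≤degree-along-ι : ∀ u → degree K u ≤ degree-along-ι u
    degree≤degree-along-ι u = ∑-mono-≤ (allFin (n K)) (λ v → indicator-mono _ _ (subgraph u v))

    degree-along-ι≤degree : ∀ u → degree-along-ι u ≤ degree H (ι u)
    degree-along-ι≤degree u = ∑-injection-≤ ι ι-injective _ (λ w → indicator (adj H (ι u) w)) (λ _ → ℕₚ.≤-refl)

    degree-≤ : ∀ u → degree K u ≤ degree H (ι u)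
    degree-≤ u = ℕₚ.≤-trans (degree≤degree-along-ι u) (degree-along-ι≤degree u)

    vertices-≤ : n K ≤ n H
    vertices-≤ = injective⇒≤ ι-injective

    edges-≤ : edges K ≤ edges H
    edges-≤ = ∑-injection-≤ ι ι-injective (degree K) (degree H) degree-≤

  size-embedding-≤ : size K ≤ size H
  size-embedding-≤ = subst₂ _≤_ (sym (size≡vertices+edges K)) (sym (size≡vertices+edges H))
                       (ℕₚ.+-mono-≤ vertices-≤ edges-≤)

  size-embedding-≡⇒≃ : size K ≡ size H → K ≃ H
  size-embedding-≡⇒≃ size≡ = record
    { to      = ι
    ; from    = proj₁ ∘ onto
    ; from∘to = λ u → ι-injective (proj₂ (onto (ι u)))
    ; to∘from = proj₂ ∘ onto
    ; adj-to  = adj-equal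
    }
    where
    tight : n K ≡ n H × edges K ≡ edges H
    tight = +-tight vertices-≤ edges-≤ (trans (sym (size≡vertices+edges K)) (trans size≡ (size≡vertices+edges H)))
    onto : ∀ a → InImage ι a
    onto a = when-1⇒ (inImage? ι a)
      (proj₂ (∑-injection-≡ ι ι-injective (λ _ → 1) (λ _ → 1) (λ _ → ℕₚ.≤-refl)
                (trans (∑-ones (n K)) (trans (proj₁ tight) (sym (∑-ones (n H)))))) a)
    adj-equal : ∀ u v → adj K u v ≡ adj H (ι u) (ι v)
    adj-equal u v = indicator-injective _ _
      (∑-tight (allFin (n K)) (λ v → indicator-mono _ _ (subgraph u v)) degree≡degree-along-ι v (∈ₚ.∈-allFin v))
      where
      degree≡ : degree K u ≡ degree H (ι u)
      degree≡ = proj₁ (∑-injection-≡ ι ι-injective (degree K) (degree H) degree-≤ (proj₂ tight)) u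
      degree≡degree-along-ι : degree K u ≡ degree-along-ι u
      degree≡degree-along-ι = ℕₚ.≤-antisym (degree≤degree-along-ι u)
        (subst (degree-along-ι u ≤_) (sym degree≡) (degree-along-ι≤degree u))

SubConditions⇒Embedding : ∀ {H K} (ι : Fin (n K) → Fin (n H)) → StrictlyIncreasing ι → SubConditions H K ι →
                          Embedding H K
SubConditions⇒Embedding ι ι-increasing (sub , loops , _) =
  record { ι = ι ; increasing = ι-increasing ; subgraph = sub ; loop-hereditary = loops }

id-increasing : ∀ {m} → StrictlyIncreasing {m} id
id-increasing _ _ i<j = i<j

μ-self : ∀ H → NonEmpty H → Connected H → μ H H ≡ 1
μ-self H H-nonempty H-connected = begin
  μ H H                                 ≡⟨ count-∑ (_≅? H) (Sub H) ⟩
  ∑ (Sub H) F                           ≡⟨ ∑-Sub H F ⟩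
  ∑-parameters H S                      ≡⟨ ∑-parameters-single H S (candidate-cong H F F-resp) id (adj H)
                                             H-nonempty ℕₚ.≤-refl id-increasing k-unique ι-unique A-unique ⟩
  S (n H) id (adj H)                    ≡⟨ cong (maybe′ F 0) (proj₂ accepts) ⟩
  F H-copy                              ≡⟨ when-yes (H-copy ≅? H) 1 (≃⇒≅ {H-copy} {H} (≃-same-adj _ _ _ _ (λ _ _ → refl))) ⟩
  1                                     ∎
  where
  open ≡-Reasoning
  F : Graph → ℕ
  F K = when (K ≅? H) 1
  S : Summand H
  S k ι A = maybe′ F 0 (candidate H k ι A)
  F-resp : ∀ {K K'} → K ≃ K' → F K ≡ F K'
  F-resp {K} {K'} d =
    when-⇔ (K ≅? H) (K' ≅? H) 1 (≅-trans {K'} {K} {H} (≃⇒≅ (≃-sym d))) (≅-trans {K} {K'} {H} (≃⇒≅ d))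
  accepts : ∃ λ s → candidate H (n H) id (adj H) ≡ just (mkGraph (n H) (adj H) s)
  accepts = candidate-accepts H (adj-sym H) ((λ _ _ a → a) , (λ _ l → l) , H-connected)
  H-copy : Graph
  H-copy = mkGraph (n H) (adj H) (proj₁ accepts)
  -- A member of Sub H isomorphic to H has the size of H, so its embedding is onto.
  iso-along : ∀ {k} {ι : Fin k → Fin (n H)} {A} → StrictlyIncreasing ι → S k ι A ≢ 0 →
              ∃ λ s → Σ (mkGraph k A s ≃ H) λ d → ∀ u → to d u ≡ ι u
  iso-along {k} {ι} {A} ι-increasing S≢0 =
    let (s , conds , F≢0) = candidate-≢0 H F S≢0
    in s , size-embedding-≡⇒≃ (SubConditions⇒Embedding ι ι-increasing conds)
             (size-≃ (≅⇒≃ {mkGraph k A s} {H} (when-≢ε (mkGraph k A s ≅? H) F≢0))) , λ _ → refl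
  k-unique : ∀ {k} (ι : Fin k → Fin (n H)) A → StrictlyIncreasing ι → S k ι A ≢ 0 → k ≡ n H
  k-unique ι A ι-increasing S≢0 = ≃-vertices (proj₁ (proj₂ (iso-along ι-increasing S≢0)))
  ι-unique : ∀ ι A → StrictlyIncreasing ι → S (n H) ι A ≢ 0 → ∀ i → ι i ≡ i
  ι-unique ι A ι-increasing S≢0 =
    let (_ , d , to≐ι) = iso-along ι-increasing S≢0
    in sameImage⇒≐ ι-increasing id-increasing
         (λ a → (λ _ → a , refl) , (λ _ → from d a , trans (sym (to≐ι (from d a))) (to∘from d a)))
  A-unique : ∀ A → S (n H) id A ≢ 0 → ∀ u v → A u v ≡ adj H u v
  A-unique A S≢0 u v =
    let (_ , d , to≐id) = iso-along id-increasing S≢0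
    in trans (adj-to d u v) (cong₂ (adj H) (to≐id u) (to≐id v))

μ-≅ : ∀ H {J J'} → J ≅ J' → μ H J ≡ μ H J'
μ-≅ H {J} {J'} J≅J' = trans (count-∑ (_≅? J) (Sub H)) (trans
  (∑-cong (Sub H) (λ K → when-⇔ (K ≅? J) (K ≅? J') 1 (λ K≅J → ≅-trans {K} {J} {J'} K≅J J≅J')
                                                     (λ K≅J' → ≅-trans {K} {J'} {J} K≅J' (≅-sym {J} {J'} J≅J'))))
  (sym (count-∑ (_≅? J') (Sub H))))

module _ (G H : Graph) where

  Factors : ∀ {K : Graph} → (Fin (n K) → Fin (n H)) → (Fin (n G) → Fin (n H)) → Set
  Factors {K} ι h = ∃ λ c → (∀ u → ι (c u) ≡ h u) × IsCompaction G K c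

  factors? : ∀ {K} (ι : Fin (n K) → Fin (n H)) h → Dec (Factors {K} ι h)
  factors? {K} ι h with Any.any? (λ c → all? (λ u → ι (c u) ≟ h u) ×-dec isCompaction? G K c) (allFuns (n G) (n K))
  ... | yes found = yes (satisfied found)
  ... | no ¬found = no λ (c , ι∘c≐h , c-compaction) → ¬found
        (Any.map (λ {c'} c'≐c → (λ u → trans (cong ι (c'≐c u)) (ι∘c≐h u)) ,
                                IsCompaction-resp {G} {K} c c' (sym ∘ c'≐c) c-compaction)
          (count≡1⇒Any _ (allFuns (n G) (n K)) (allFuns-enumerates (n G) (n K) c)))

  Factors-resp : ∀ {K} (ι : Fin (n K) → Fin (n H)) h h' → (∀ u → h u ≡ h' u) → Factors {K} ι h → Factors {K} ι h'
  Factors-resp ι h h' h≐h' (c , ι∘c≐h , c-compaction) = c , (λ u → trans (ι∘c≐h u) (h≐h' u)) , c-compaction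

  Factors⇒IsHom : ∀ {K} (ι : Fin (n K) → Fin (n H)) → IsSubgraphVia H K ι → ∀ h → Factors {K} ι h → IsHom G H h
  Factors⇒IsHom ι sub h (c , ι∘c≐h , (c-hom , _ , _)) u v a =
    subst T (cong₂ (adj H) (ι∘c≐h u) (ι∘c≐h v)) (sub (c u) (c v) (c-hom u v a))

  comp-via-injection : ∀ {K} (ι : Fin (n K) → Fin (n H)) → Injective _≡_ _≡_ ι →
                       comp G K ≡ ∑ (allFuns (n G) (n H)) (λ h → when (factors? {K} ι h) 1)
  comp-via-injection {K} ι ι-injective = begin
    comp G K
      ≡⟨ count-∑ (isCompaction? G K) (allFuns (n G) (n K)) ⟩
    ∑ (allFuns (n G) (n K)) (λ c → when (isCompaction? G K c) 1)
      ≡⟨ ∑-cong (allFuns (n G) (n K)) (λ c → when-⇔ (isCompaction? G K c) (factors? {K} ι (ι ∘ c)) 1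
           (λ c-compaction → c , (λ _ → refl) , c-compaction)
           (λ (c' , ι∘c'≐ι∘c , c'-compaction) →
              IsCompaction-resp {G} {K} c' c (λ u → ι-injective (ι∘c'≐ι∘c u)) c'-compaction)) ⟩
    ∑ (allFuns (n G) (n K)) (λ c → when (factors? {K} ι (ι ∘ c)) 1)
      ≡⟨ ∑-allFuns-injection ι ι-injective (n G) _ congruent
           (λ h u ∉ι → when-no (factors? {K} ι h) 1 (λ (c , ι∘c≐h , _) → ∉ι (c u , ι∘c≐h u))) ⟨
    ∑ (allFuns (n G) (n H)) (λ h → when (factors? {K} ι h) 1) ∎
    where
    open ≡-Reasoning
    congruent : Congruent (λ h → when (factors? {K} ι h) 1)
    congruent h h' h≐h' = when-⇔ (factors? {K} ι h) (factors? {K} ι h') 1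
      (Factors-resp {K} ι h h' h≐h') (Factors-resp {K} ι h' h (sym ∘ h≐h'))

  through-view : ∀ {k} {ι : Fin k → Fin (n H)} {A m} → CandidateView H k ι A m → (Fin (n G) → Fin (n H)) → ℕ
  through-view             (rejected _)   h = 0
  through-view {k} {ι} {A} (accepted s _) h = when (factors? {mkGraph k A s} ι h) 1

  -- 1 exactly when (k, ι, A) generates a member K of Sub H and h = ι ∘ c for a compaction c : G → K.
  Through : ∀ k (ι : Fin k → Fin (n H)) A → (Fin (n G) → Fin (n H)) → ℕ
  Through k ι A = through-view (candidate-view H k ι A)

  comp-candidate : ∀ {k} (ι : Fin k → Fin (n H)) A → StrictlyIncreasing ι →
                   maybe′ (comp G) 0 (candidate H k ι A) ≡ ∑ (allFuns (n G) (n H)) (Through k ι A)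
  comp-candidate {k} ι A ι-increasing = go (candidate-view H k ι A)
    where
    go : ∀ {m} (view : CandidateView H k ι A m) → maybe′ (comp G) 0 m ≡ ∑ (allFuns (n G) (n H)) (through-view view)
    go (rejected _)   = sym (∑-ε (allFuns (n G) (n H)) (λ _ → refl))
    go (accepted s _) = comp-via-injection {mkGraph k A s} ι (increasing⇒injective ι-increasing)

  Through-≢0 : ∀ {k} {ι : Fin k → Fin (n H)} {A} h → Through k ι A h ≢ 0 →
               ∃ λ s → SubConditions H (mkGraph k A s) ι × Factors {mkGraph k A s} ι h
  Through-≢0 {k} {ι} {A} h ≢0 = go (candidate-view H k ι A) ≢0
    where
    go : ∀ {m} (view : CandidateView H k ι A m) → through-view view h ≢ 0 →
         ∃ λ s → SubConditions H (mkGraph k A s) ι × Factors {mkGraph k A s} ι h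
    go (rejected _)   ≢0 = ⊥-elim (≢0 refl)
    go (accepted s c) ≢0 = s , c , when-≢ε (factors? {mkGraph k A s} ι h) ≢0

  Through-cong : ∀ {k} {ι ι' : Fin k → Fin (n H)} {A A'} → (∀ i → ι i ≡ ι' i) → (∀ u v → A u v ≡ A' u v) →
                 ∀ h → Through k ι A h ≡ Through k ι' A' h
  Through-cong {k} {ι} {ι'} {A} {A'} ι≐ι' A≐A' h = go (candidate-view H k ι A) (candidate-view H k ι' A')
    where
    go : ∀ {m m'} (view : CandidateView H k ι A m) (view' : CandidateView H k ι' A' m') → through-view view h ≡ through-view view' h
    go (rejected _)   (rejected _)    = refl
    go (accepted s _) (accepted s' _) = when-⇔ (factors? {mkGraph k A s} ι h) (factors? {mkGraph k A' s'} ι' h) 1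
      (λ (c , ι∘c≐h , c-compaction) → c , (λ u → trans (sym (ι≐ι' (c u))) (ι∘c≐h u)) ,
                                         IsCompaction-≃ {G} (≃-same-adj A A' s s' A≐A') c c-compaction)
      (λ (c , ι'∘c≐h , c-compaction) → c , (λ u → trans (ι≐ι' (c u)) (ι'∘c≐h u)) ,
                                          IsCompaction-≃ {G} (≃-same-adj A' A s' s (λ u v → sym (A≐A' u v))) c c-compaction)
    go (rejected ¬c)  (accepted s' c) = ⊥-elim (¬c s (SubConditions-cong H s' s ι≐ι' A≐A' c))
      where s = λ u v → trans (A≐A' u v) (trans (s' u v) (sym (A≐A' v u)))
    go (accepted s c) (rejected ¬c)   = ⊥-elim (¬c s' (SubConditions-cong H s s' (sym ∘ ι≐ι') (λ u v → sym (A≐A' u v)) c))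
      where s' = λ u v → trans (sym (A≐A' u v)) (trans (s u v) (A≐A' v u))

  module Image (h : Fin (n G) → Fin (n H)) (h-hom : IsHom G H h) where

    open IncreasingEnumeration (increasingEnumeration (n H) (InImage h) (inImage? h))
      renaming (k to k₀; ι to ι₀; increasing to ι₀-increasing)

    ι₀-injective : Injective _≡_ _≡_ ι₀
    ι₀-injective = increasing⇒injective ι₀-increasing

    h₀ : Fin (n G) → Fin k₀
    h₀ u = proj₁ (P⊆image (h u) (u , refl))

    ι₀∘h₀≐h : ∀ u → ι₀ (h₀ u) ≡ h u
    ι₀∘h₀≐h u = proj₂ (P⊆image (h u) (u , refl))

    -- The image subgraph of h: the edges of G mapped by h, together with all loops of H on the image.
    ImageAdj : Fin k₀ → Fin k₀ → Set
    ImageAdj u v = T (adj H (ι₀ u) (ι₀ v)) × (u ≡ v ⊎ ∃ λ x → ∃ λ y → T (adj G x y) × h₀ x ≡ u × h₀ y ≡ v)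

    imageAdj? : ∀ u v → Dec (ImageAdj u v)
    imageAdj? u v = T? (adj H (ι₀ u) (ι₀ v))
      ×-dec ((u ≟ v) ⊎-dec any? (λ x → any? (λ y → T? (adj G x y) ×-dec (h₀ x ≟ u) ×-dec (h₀ y ≟ v))))

    ImageAdj-sym : ∀ u v → ImageAdj u v → ImageAdj v u
    ImageAdj-sym u v (a , inj₁ u≡v) = subst T (adj-sym H (ι₀ u) (ι₀ v)) a , inj₁ (sym u≡v)
    ImageAdj-sym u v (a , inj₂ (x , y , a' , x↦u , y↦v)) =
      subst T (adj-sym H (ι₀ u) (ι₀ v)) a , inj₂ (y , x , subst T (adj-sym G x y) a' , y↦v , x↦u)

    A₀ : Fin k₀ → Fin k₀ → Bool
    A₀ u v = ⌊ imageAdj? u v ⌋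

    A₀-sym : ∀ u v → A₀ u v ≡ A₀ v u
    A₀-sym u v = T-extensional _ _ (fromWitness ∘ ImageAdj-sym u v ∘ toWitness) (fromWitness ∘ ImageAdj-sym v u ∘ toWitness)

    K₀ : Graph
    K₀ = mkGraph k₀ A₀ A₀-sym

    h₀-hom : IsHom G K₀ h₀
    h₀-hom x y a = fromWitness (subst T (sym (cong₂ (adj H) (ι₀∘h₀≐h x) (ι₀∘h₀≐h y))) (h-hom x y a) ,
                                inj₂ (x , y , a , refl , refl))

    h₀-onto : ∀ w → InImage h₀ w
    h₀-onto w = let (u , hu≡ι₀w) = image⊆P (ι₀ w) (w , refl) in u , ι₀-injective (trans (ι₀∘h₀≐h u) hu≡ι₀w)

    h₀-compaction : IsCompaction G K₀ h₀
    h₀-compaction = h₀-hom , h₀-onto , onto-edges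
      where
      onto-edges : ∀ w₁ w₂ → w₁ ≢ w₂ → T (A₀ w₁ w₂) → ∃ λ u₁ → ∃ λ u₂ → T (adj G u₁ u₂) × h₀ u₁ ≡ w₁ × h₀ u₂ ≡ w₂
      onto-edges w₁ w₂ w₁≢w₂ a with toWitness {a? = imageAdj? w₁ w₂} a
      ... | (_ , inj₁ w₁≡w₂) = ⊥-elim (w₁≢w₂ w₁≡w₂)
      ... | (_ , inj₂ edge)   = edge

    K₀-conditions : Connected G → SubConditions H K₀ ι₀
    K₀-conditions G-connected =
      (λ u v a → proj₁ (toWitness {a? = imageAdj? u v} a)) ,
      (λ u l → fromWitness (l , inj₁ refl)) ,
      Connected-onto h₀ h₀-hom h₀-onto G-connected

    Factors⇒sameImage : ∀ {k} (ι : Fin k → Fin (n H)) A s → Factors {mkGraph k A s} ι h → SameImage ι ι₀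
    Factors⇒sameImage ι A s (c , ι∘c≐h , (_ , c-onto , _)) a =
      (λ (b , ιb≡a) → let (u , cu≡b) = c-onto b in P⊆image a (u , trans (sym (ι∘c≐h u)) (trans (cong ι cu≡b) ιb≡a))) ,
      (λ a∈ → let (u , hu≡a) = image⊆P a a∈ in c u , trans (ι∘c≐h u) hu≡a)

    -- Adjacency of any factorisation through ι₀ is forced: a loop comes from H, any other edge from G.
    Factors⇒adj : ∀ A s → SubConditions H (mkGraph k₀ A s) ι₀ → Factors {mkGraph k₀ A s} ι₀ h →
                  ∀ u v → A u v ≡ A₀ u v
    Factors⇒adj A s (sub , loops , _) (c , ι₀∘c≐h , (c-hom , _ , onto-edges)) u v =
      T-extensional _ _ A⇒A₀ A₀⇒A
      where
      c≐h₀ : ∀ x → c x ≡ h₀ x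
      c≐h₀ x = ι₀-injective (trans (ι₀∘c≐h x) (sym (ι₀∘h₀≐h x)))
      A⇒A₀ : T (A u v) → T (A₀ u v)
      A⇒A₀ a with u ≟ v
      ... | yes u≡v = fromWitness (sub u v a , inj₁ u≡v)
      ... | no u≢v  = let (x , y , a' , cx≡u , cy≡v) = onto-edges u v u≢v a
                      in fromWitness (sub u v a , inj₂ (x , y , a' , trans (sym (c≐h₀ x)) cx≡u , trans (sym (c≐h₀ y)) cy≡v))
      A₀⇒A : T (A₀ u v) → T (A u v)
      A₀⇒A a with toWitness {a? = imageAdj? u v} a
      ... | (l , inj₁ refl) = loops u l
      ... | (_ , inj₂ (x , y , a' , x↦u , y↦v)) = subst T (cong₂ A (trans (c≐h₀ x) x↦u) (trans (c≐h₀ y) y↦v)) (c-hom x y a')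

    Through-image : Connected G → Through k₀ ι₀ A₀ h ≡ 1
    Through-image G-connected = go (candidate-view H k₀ ι₀ A₀)
      where
      go : ∀ {m} (view : CandidateView H k₀ ι₀ A₀ m) → through-view view h ≡ 1
      go (rejected ¬c)  = ⊥-elim (¬c A₀-sym (K₀-conditions G-connected))
      go (accepted s _) = when-yes (factors? {mkGraph k₀ A₀ s} ι₀ h) 1
        (h₀ , ι₀∘h₀≐h , IsCompaction-≃ {G} (≃-same-adj A₀ A₀ A₀-sym s (λ _ _ → refl)) h₀ h₀-compaction)

    ∑-parameters-Through : NonEmpty G → Connected G → ∑-parameters H (λ k ι A → Through k ι A h) ≡ 1
    ∑-parameters-Through G-nonempty G-connected =
      trans (∑-parameters-single H (λ k ι A → Through k ι A h) (λ ι≐ι' A≐A' → Through-cong ι≐ι' A≐A' h)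
               ι₀ A₀ k₀≥1 (injective⇒≤ ι₀-injective) ι₀-increasing k-unique ι-unique A-unique)
        (Through-image G-connected)
      where
      k₀≥1 : 1 ≤ k₀
      k₀≥1 = ℕₚ.≤-trans (s≤s z≤n) (toℕ<n (h₀ (Fin.fromℕ< G-nonempty)))
      k-unique : ∀ {k} (ι : Fin k → Fin (n H)) A → StrictlyIncreasing ι → Through k ι A h ≢ 0 → k ≡ k₀
      k-unique ι A ι-increasing ≢0 = let (s , _ , factors) = Through-≢0 h ≢0
        in sameImage⇒same-size ι-increasing ι₀-increasing (Factors⇒sameImage ι A s factors)
      ι-unique : ∀ ι A → StrictlyIncreasing ι → Through k₀ ι A h ≢ 0 → ∀ i → ι i ≡ ι₀ i
      ι-unique ι A ι-increasing ≢0 = let (s , _ , factors) = Through-≢0 h ≢0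
        in sameImage⇒≐ ι-increasing ι₀-increasing (Factors⇒sameImage ι A s factors)
      A-unique : ∀ A → Through k₀ ι₀ A h ≢ 0 → ∀ u v → A u v ≡ A₀ u v
      A-unique A ≢0 = let (s , conditions , factors) = Through-≢0 h ≢0 in Factors⇒adj A s conditions factors

  hom-decomposition : NonEmpty G → Connected G → ∑ (Sub H) (comp G) ≡ hom G H
  hom-decomposition G-nonempty G-connected = begin
    ∑ (Sub H) (comp G)
      ≡⟨ ∑-Sub H (comp G) ⟩
    ∑-parameters H (λ k ι A → maybe′ (comp G) 0 (candidate H k ι A))
      ≡⟨ ∑-parameters-cong H _ _ comp-candidate ⟩
    ∑-parameters H (λ k ι A → ∑ maps (Through k ι A))
      ≡⟨ ∑-parameters-swap H maps (λ h k ι A → Through k ι A h) ⟩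
    ∑ maps (λ h → ∑-parameters H (λ k ι A → Through k ι A h))
      ≡⟨ ∑-cong maps through-image ⟩
    ∑ maps (λ h → when (isHom? G H h) 1)
      ≡⟨ count-∑ (isHom? G H) maps ⟨
    hom G H ∎
    where
    open ≡-Reasoning
    maps : List (Fin (n G) → Fin (n H))
    maps = allFuns (n G) (n H)
    through-image : ∀ h → ∑-parameters H (λ k ι A → Through k ι A h) ≡ when (isHom? G H h) 1
    through-image h with isHom? G H h
    ... | yes h-hom = Image.∑-parameters-Through h h-hom G-nonempty G-connected
    ... | no ¬hom   = ∑-parameters-ε H _ (λ {k} ι A _ → vanishes (λ ≢0 →
                        let (s , (sub , _) , factors) = Through-≢0 h ≢0
                        in Factors⇒IsHom {mkGraph k A s} ι sub h factors) ¬hom)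

𝒮⊆Sub : ∀ H {J} → J ∈ 𝒮 H → J ∈ Sub H
𝒮⊆Sub H = Anyₚ.deduplicate⁻ _≅?_

Sub⊆𝒮 : ∀ H {K} → K ∈ Sub H → Any (K ≅_) (𝒮 H)
Sub⊆𝒮 H {K} K∈ = Anyₚ.deduplicate⁺ _≅?_ (λ {a} {b} b≅a K≅a → ≅-trans {K} {a} {b} K≅a (≅-sym {b} {a} b≅a))
                   (Any.map (λ K≡a → subst (K ≅_) K≡a (≅-refl {K})) K∈)

𝒮-distinct : ∀ H → AllPairs (λ J J' → ¬ J ≅ J') (𝒮 H)
𝒮-distinct H = UniqueDSₚ.deduplicate-! ≅-decSetoid (Sub H)

Sub-size-≤ : ∀ H {K} → K ∈ Sub H → size K ≤ size H
Sub-size-≤ H K∈ = size-embedding-≤ (SubMember.embedding (∈Sub⇒SubMember H K∈))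

Sub-size-≡⇒≅ : ∀ H {K} → K ∈ Sub H → size K ≡ size H → K ≅ H
Sub-size-≡⇒≅ H {K} K∈ size≡ = ≃⇒≅ {K} {H} (size-embedding-≡⇒≃ (SubMember.embedding (∈Sub⇒SubMember H K∈)) size≡)

proper : Graph → List Graph
proper H = filter (λ H' → ¬? (H' ≅? H)) (𝒮 H)

∈proper⁻ : ∀ H {H'} → H' ∈ proper H → H' ∈ 𝒮 H × ¬ H' ≅ H
∈proper⁻ H = ∈ₚ.∈-filter⁻ (λ H' → ¬? (H' ≅? H)) {xs = 𝒮 H}

proper-size-< : ∀ H {H'} → H' ∈ proper H → size H' < size H
proper-size-< H {H'} H'∈ =
  let (H'∈𝒮 , H'≇H) = ∈proper⁻ H H'∈
  in ℕₚ.≤∧≢⇒< (Sub-size-≤ H (𝒮⊆Sub H H'∈𝒮)) (H'≇H ∘ Sub-size-≡⇒≅ H (𝒮⊆Sub H H'∈𝒮))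

≅Sub⇒≅𝒮 : ∀ H {J} → Any (J ≅_) (Sub H) → Any (J ≅_) (𝒮 H)
≅Sub⇒≅𝒮 H {J} J≅∈ with find J≅∈
... | K , K∈ , J≅K = Any.map (λ {L} K≅L → ≅-trans {J} {K} {L} J≅K K≅L) (Sub⊆𝒮 H K∈)

H∈𝒮H : ∀ H → NonEmpty H → Connected H → Any (_≅ H) (𝒮 H)
H∈𝒮H H H-nonempty H-connected =
  Any.map (λ {J} H≅J → ≅-sym {H} {J} H≅J)
    (≅Sub⇒≅𝒮 H {H} (Sub-complete H id id-increasing H-nonempty ℕₚ.≤-refl (adj H) (adj-sym H)
                  ((λ _ _ a → a) , (λ _ l → l) , H-connected)))

count-𝒮-self : ∀ H → NonEmpty H → Connected H → count (_≅? H) (𝒮 H) ≡ 1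
count-𝒮-self H H-nonempty H-connected =
  count-unique (_≅? H) (𝒮 H) (𝒮-distinct H) (λ {a} {b} a≅H b≅H → ≅-trans {a} {H} {b} a≅H (≅-sym {b} {H} b≅H))
    (H∈𝒮H H H-nonempty H-connected)

Sub-trans : ∀ H {H' J} → SubMember H H' → SubMember H' J → Any (J ≅_) (Sub H)
Sub-trans H {H'} {J} M₁ M₂ =
  Sub-complete H (E₁.ι ∘ E₂.ι) ι-increasing (SubMember.nonempty M₂)
    (injective⇒≤ (increasing⇒injective ι-increasing)) (adj J) (adj-sym J) conditions
  where
  module E₁ = Embedding (SubMember.embedding M₁)
  module E₂ = Embedding (SubMember.embedding M₂)
  ι-increasing : StrictlyIncreasing (E₁.ι ∘ E₂.ι)
  ι-increasing a b a<b = E₁.increasing _ _ (E₂.increasing a b a<b)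
  conditions : SubConditions H J (E₁.ι ∘ E₂.ι)
  conditions = (λ u v a → E₁.subgraph _ _ (E₂.subgraph u v a)) ,
               (λ u l → E₂.loop-hereditary u (E₁.loop-hereditary (E₂.ι u) l)) , SubMember.connected M₂

𝒮-Sub⊆𝒮 : ∀ H {H'} → H' ∈ Sub H → ∀ J → J ∈ 𝒮 H' → Any (J ≅_) (𝒮 H)
𝒮-Sub⊆𝒮 H {H'} H'∈ J J∈ =
  ≅Sub⇒≅𝒮 H {J} (Sub-trans H (∈Sub⇒SubMember H H'∈) (∈Sub⇒SubMember H' (𝒮⊆Sub H' J∈)))

∑-Sub-by-classes : ∀ H (F : Graph → ℕ) → (∀ {K K'} → K ≅ K' → F K ≡ F K') →
                   ∑ (Sub H) F ≡ ∑ (𝒮 H) (λ J → μ H J ℕ.* F J)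
∑-Sub-by-classes H F F-resp = begin
  ∑ (Sub H) F
    ≡⟨ ∑-cong∈ (Sub H) (λ K K∈ → sym (∑-when-single (K ≅?_) (𝒮 H)
         (count-unique (K ≅?_) (𝒮 H) (𝒮-distinct H) (λ {a} {b} K≅a K≅b → ≅-trans {a} {K} {b} (≅-sym {K} {a} K≅a) K≅b)
           (Sub⊆𝒮 H K∈)) _ (F K) (λ _ _ → refl))) ⟩
  ∑ (Sub H) (λ K → ∑ (𝒮 H) (λ J → when (K ≅? J) (F K)))
    ≡⟨ ∑-swap (Sub H) (𝒮 H) _ ⟩
  ∑ (𝒮 H) (λ J → ∑ (Sub H) (λ K → when (K ≅? J) (F K)))
    ≡⟨ ∑-cong (𝒮 H) (λ J → ∑-cong (Sub H) (λ K → when-congʳ (K ≅? J) F-resp)) ⟩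
  ∑ (𝒮 H) (λ J → ∑ (Sub H) (λ K → when (K ≅? J) (F J)))
    ≡⟨ ∑-cong (𝒮 H) (λ J → ∑-when-const (_≅? J) (Sub H) (F J)) ⟩
  ∑ (𝒮 H) (λ J → μ H J ℕ.* F J) ∎
  where open ≡-Reasoning

hom-split : ∀ G H → NonEmpty G → Connected G → NonEmpty H → Connected H →
            hom G H ≡ comp G H ℕ.+ ∑ (proper H) (λ H' → μ H H' ℕ.* comp G H')
hom-split G H G-nonempty G-connected H-nonempty H-connected = begin
  hom G H
    ≡⟨ hom-decomposition G H G-nonempty G-connected ⟨
  ∑ (Sub H) (comp G)
    ≡⟨ ∑-Sub-by-classes H (comp G) (λ {K} {K'} K≅K' → comp-≃ G (≅⇒≃ {K} {K'} K≅K')) ⟩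
  ∑ (𝒮 H) (λ J → μ H J ℕ.* comp G J)
    ≡⟨ ∑-split (_≅? H) (𝒮 H) _ ⟩
  ∑ (𝒮 H) (λ J → when (J ≅? H) (μ H J ℕ.* comp G J)) ℕ.+ ∑ (proper H) (λ H' → μ H H' ℕ.* comp G H')
    ≡⟨ cong (ℕ._+ rest) (∑-when-single (_≅? H) (𝒮 H) (count-𝒮-self H H-nonempty H-connected) _ _
         (λ J J≅H → cong₂ ℕ._*_ (μ-≅ H {J} {H} J≅H) (comp-≃ G (≅⇒≃ {J} {H} J≅H)))) ⟩
  μ H H ℕ.* comp G H ℕ.+ ∑ (proper H) (λ H' → μ H H' ℕ.* comp G H')
    ≡⟨ cong (λ m → m ℕ.* comp G H ℕ.+ rest) (μ-self H H-nonempty H-connected) ⟩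
  1 ℕ.* comp G H ℕ.+ ∑ (proper H) (λ H' → μ H H' ℕ.* comp G H')
    ≡⟨ cong (ℕ._+ rest) (ℕₚ.*-identityˡ (comp G H)) ⟩
  comp G H ℕ.+ ∑ (proper H) (λ H' → μ H H' ℕ.* comp G H') ∎
  where
  open ≡-Reasoning
  rest : ℕ
  rest = ∑ (proper H) (λ H' → μ H H' ℕ.* comp G H')

module ℤ∑ = ListSum ℤₚ.+-0-isCommutativeMonoid

λ-outside : ∀ f H J → ¬ Any (J ≅_) (𝒮 H) → λ-fuel (suc f) H J ≡ + 0
λ-outside f H J J∉ with Any.any? (λ H' → J ≅? H') (𝒮 H)
... | yes J∈ = ⊥-elim (J∉ J∈)
... | no _   = refl

λ-top : ∀ f H J → Any (J ≅_) (𝒮 H) → J ≅ H → λ-fuel (suc f) H J ≡ + 1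
λ-top f H J J∈ J≅H with Any.any? (λ H' → J ≅? H') (𝒮 H)
... | no J∉ = ⊥-elim (J∉ J∈)
... | yes _ with J ≅? H
...   | yes _   = refl
...   | no J≇H = ⊥-elim (J≇H J≅H)

λ-below : ∀ f H J → Any (J ≅_) (𝒮 H) → ¬ J ≅ H →
          λ-fuel (suc f) H J ≡ - ℤ∑.∑ (proper H) (λ H' → + μ H H' ℤ.* λ-fuel f H' J)
λ-below f H J J∈ J≇H with Any.any? (λ H' → J ≅? H') (𝒮 H)
... | no J∉ = ⊥-elim (J∉ J∈)
... | yes _ with J ≅? H
...   | yes J≅H = ⊥-elim (J≇H J≅H)
...   | no _    = refl

λ-fuel-stable : ∀ f f' H J → suc (size H) ≤ f → suc (size H) ≤ f' → λ-fuel f H J ≡ λ-fuel f' H J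
λ-fuel-stable (suc f) (suc f') H J (s≤s size≤f) (s≤s size≤f') with Any.any? (λ H' → J ≅? H') (𝒮 H)
... | no _  = refl
... | yes _ with J ≅? H
...   | yes _ = refl
...   | no _  = cong -_ (ℤ∑.∑-cong∈ (proper H) (λ H' H'∈ → cong (+ μ H H' ℤ.*_)
                  (λ-fuel-stable f f' H' J (ℕₚ.≤-trans (proper-size-< H H'∈) size≤f)
                                           (ℕₚ.≤-trans (proper-size-< H H'∈) size≤f'))))

λ-fuel-≅ : ∀ f H {J J'} → J ≅ J' → λ-fuel f H J ≡ λ-fuel f H J'
λ-fuel-≅ zero    H J≅J' = refl
λ-fuel-≅ (suc f) H {J} {J'} J≅J' with Any.any? (λ H' → J ≅? H') (𝒮 H) | Any.any? (λ H' → J' ≅? H') (𝒮 H)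
... | no _   | no _    = refl
... | yes J∈ | no J'∉ = ⊥-elim (J'∉ (Any.map (λ {L} → ≅-trans {J'} {J} {L} (≅-sym {J} {J'} J≅J')) J∈))
... | no J∉  | yes J'∈ = ⊥-elim (J∉ (Any.map (λ {L} → ≅-trans {J} {J'} {L} J≅J') J'∈))
... | yes _  | yes _ with J ≅? H | J' ≅? H
...   | yes _   | yes _    = refl
...   | yes J≅H | no J'≇H = ⊥-elim (J'≇H (≅-trans {J'} {J} {H} (≅-sym {J} {J'} J≅J') J≅H))
...   | no J≇H  | yes J'≅H = ⊥-elim (J≇H (≅-trans {J} {J'} {H} J≅J' J'≅H))
...   | no _    | no _     = cong -_ (ℤ∑.∑-cong (proper H) (λ H' → cong (+ μ H H' ℤ.*_) (λ-fuel-≅ f H' J≅J')))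

λ-≅ : ∀ H {J J'} → J ≅ J' → λ[ H ] J ≡ λ[ H ] J'
λ-≅ H = λ-fuel-≅ (suc (size H)) H

λ-not-in-𝒮 : ∀ H J → ¬ Any (J ≅_) (𝒮 H) → λ[ H ] J ≡ + 0
λ-not-in-𝒮 H = λ-outside (size H) H

λ-larger : ∀ H J → size H < size J → λ[ H ] J ≡ + 0
λ-larger H J H<J = λ-not-in-𝒮 H J λ J∈ →
  let (K , K∈ , J≅K) = find J∈
  in ℕₚ.<⇒≱ H<J (subst (_≤ size H) (sym (size-≃ (≅⇒≃ {J} {K} J≅K))) (Sub-size-≤ H (𝒮⊆Sub H K∈)))

λ-self : ∀ H J → J ∈ 𝒮 H → J ≅ H → λ[ H ] J ≡ + 1
λ-self H J J∈ = λ-top (size H) H J (lose J∈ (≅-refl {J}))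

λ-recursion : ∀ H J → J ∈ 𝒮 H → ¬ J ≅ H → λ[ H ] J ≡ - ℤ∑.∑ (proper H) (λ H' → + μ H H' ℤ.* λ[ H' ] J)
λ-recursion H J J∈ J≇H = trans (λ-below (size H) H J (lose J∈ (≅-refl {J})) J≇H)
  (cong -_ (ℤ∑.∑-cong∈ (proper H) (λ H' H'∈ → cong (+ μ H H' ℤ.*_)
    (λ-fuel-stable (size H) (suc (size H')) H' J (proper-size-< H H'∈) ℕₚ.≤-refl))))

ℤ∑-neg : {A : Set} (xs : List A) (f : A → ℤ) → ℤ∑.∑ xs (λ x → - f x) ≡ - ℤ∑.∑ xs f
ℤ∑-neg []       f = refl
ℤ∑-neg (x ∷ xs) f = trans (cong (λ z → (- f x) ℤ.+ z) (ℤ∑-neg xs f)) (sym (ℤₚ.neg-distrib-+ (f x) (ℤ∑.∑ xs f)))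

ℤ∑-*ˡ : {A : Set} (c : ℤ) (xs : List A) (f : A → ℤ) → c ℤ.* ℤ∑.∑ xs f ≡ ℤ∑.∑ xs (λ x → c ℤ.* f x)
ℤ∑-*ˡ c []       f = ℤₚ.*-zeroʳ c
ℤ∑-*ˡ c (x ∷ xs) f = trans (ℤₚ.*-distribˡ-+ c (f x) (ℤ∑.∑ xs f)) (cong (λ z → c ℤ.* f x ℤ.+ z) (ℤ∑-*ˡ c xs f))

ℤ∑-+ : {A : Set} (xs : List A) (f : A → ℕ) → + ∑ xs f ≡ ℤ∑.∑ xs (λ x → + f x)
ℤ∑-+ []       f = refl
ℤ∑-+ (x ∷ xs) f = trans (ℤₚ.pos-+ (f x) (∑ xs f)) (cong (λ z → + f x ℤ.+ z) (ℤ∑-+ xs f))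

Λ : (Graph → ℤ) → Graph → ℤ
Λ w H = ℤ∑.∑ (𝒮 H) (λ J → λ[ H ] J ℤ.* w J)

module _ (w : Graph → ℤ) (w-resp : ∀ {J J'} → J ≅ J' → w J ≡ w J') (H : Graph) where

  λ-weighted : ∀ J → J ∈ 𝒮 H →
    λ[ H ] J ℤ.* w J ≡ ℤ∑.when (J ≅? H) (w J) ℤ.+ - ℤ∑.∑ (proper H) (λ H' → + μ H H' ℤ.* (λ[ H' ] J ℤ.* w J))
  λ-weighted J J∈ with J ≅? H
  ... | yes J≅H = begin
    λ[ H ] J ℤ.* w J   ≡⟨ cong (ℤ._* w J) (λ-self H J J∈ J≅H) ⟩
    + 1 ℤ.* w J        ≡⟨ ℤₚ.*-identityˡ (w J) ⟩
    w J                ≡⟨ ℤₚ.+-identityʳ (w J) ⟨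
    w J ℤ.+ - + 0      ≡⟨ cong (λ z → w J ℤ.+ - z) (ℤ∑.∑-ε∈ (proper H) (λ H' H'∈ → vanishing H' H'∈)) ⟨
    w J ℤ.+ - ℤ∑.∑ (proper H) (λ H' → + μ H H' ℤ.* (λ[ H' ] J ℤ.* w J)) ∎
    where
    open ≡-Reasoning
    vanishing : ∀ H' → H' ∈ proper H → + μ H H' ℤ.* (λ[ H' ] J ℤ.* w J) ≡ + 0
    vanishing H' H'∈ =
      trans (cong (λ z → + μ H H' ℤ.* (z ℤ.* w J))
              (λ-larger H' J (subst (size H' <_) (sym (size-≃ (≅⇒≃ {J} {H} J≅H))) (proper-size-< H H'∈))))
            (ℤₚ.*-zeroʳ (+ μ H H'))
  ... | no J≇H = begin
    λ[ H ] J ℤ.* w J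
      ≡⟨ cong (ℤ._* w J) (λ-recursion H J J∈ J≇H) ⟩
    - ℤ∑.∑ (proper H) (λ H' → + μ H H' ℤ.* λ[ H' ] J) ℤ.* w J
      ≡⟨ ℤₚ.neg-distribˡ-* (ℤ∑.∑ (proper H) _) (w J) ⟨
    - (ℤ∑.∑ (proper H) (λ H' → + μ H H' ℤ.* λ[ H' ] J) ℤ.* w J)
      ≡⟨ cong -_ (trans (ℤₚ.*-comm _ (w J)) (ℤ∑-*ˡ (w J) (proper H) _)) ⟩
    - ℤ∑.∑ (proper H) (λ H' → w J ℤ.* (+ μ H H' ℤ.* λ[ H' ] J))
      ≡⟨ cong -_ (ℤ∑.∑-cong (proper H) (λ H' → trans (ℤₚ.*-comm (w J) _) (ℤₚ.*-assoc (+ μ H H') (λ[ H' ] J) (w J)))) ⟩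
    - ℤ∑.∑ (proper H) (λ H' → + μ H H' ℤ.* (λ[ H' ] J ℤ.* w J))
      ≡⟨ ℤₚ.+-identityˡ _ ⟨
    + 0 ℤ.+ - ℤ∑.∑ (proper H) (λ H' → + μ H H' ℤ.* (λ[ H' ] J ℤ.* w J)) ∎
    where open ≡-Reasoning

  Λ-recursion : NonEmpty H → Connected H → Λ w H ≡ w H ℤ.- ℤ∑.∑ (proper H) (λ H' → + μ H H' ℤ.* Λ w H')
  Λ-recursion H-nonempty H-connected = begin
    Λ w H
      ≡⟨ ℤ∑.∑-cong∈ (𝒮 H) λ-weighted ⟩
    ℤ∑.∑ (𝒮 H) (λ J → ℤ∑.when (J ≅? H) (w J) ℤ.+ - ℤ∑.∑ (proper H) (λ H' → + μ H H' ℤ.* (λ[ H' ] J ℤ.* w J)))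
      ≡⟨ ℤ∑.∑-⊕ (𝒮 H) _ _ ⟩
    ℤ∑.∑ (𝒮 H) (λ J → ℤ∑.when (J ≅? H) (w J)) ℤ.+ ℤ∑.∑ (𝒮 H) (λ J → - ℤ∑.∑ (proper H) (λ H' → + μ H H' ℤ.* (λ[ H' ] J ℤ.* w J)))
      ≡⟨ cong₂ ℤ._+_ (ℤ∑.∑-when-single (_≅? H) (𝒮 H) (count-𝒮-self H H-nonempty H-connected) w (w H) (λ J → w-resp))
                     (ℤ∑-neg (𝒮 H) _) ⟩
    w H ℤ.- ℤ∑.∑ (𝒮 H) (λ J → ℤ∑.∑ (proper H) (λ H' → + μ H H' ℤ.* (λ[ H' ] J ℤ.* w J)))
      ≡⟨ cong (λ z → w H ℤ.- z) (ℤ∑.∑-swap (𝒮 H) (proper H) _) ⟩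
    w H ℤ.- ℤ∑.∑ (proper H) (λ H' → ℤ∑.∑ (𝒮 H) (λ J → + μ H H' ℤ.* (λ[ H' ] J ℤ.* w J)))
      ≡⟨ cong (λ z → w H ℤ.- z) (ℤ∑.∑-cong∈ (proper H) (λ H' H'∈ → trans (sym (ℤ∑-*ˡ (+ μ H H') (𝒮 H) _))
           (cong (+ μ H H' ℤ.*_) (reindex H' (𝒮⊆Sub H (proj₁ (∈proper⁻ H H'∈))))))) ⟩
    w H ℤ.- ℤ∑.∑ (proper H) (λ H' → + μ H H' ℤ.* Λ w H') ∎
    where
    open ≡-Reasoning
    reindex : ∀ H' → H' ∈ Sub H → ℤ∑.∑ (𝒮 H) (λ J → λ[ H' ] J ℤ.* w J) ≡ Λ w H'
    reindex H' H'∈ = ℤ∑.∑-representatives ≅-decSetoid (𝒮 H) (𝒮 H') (𝒮-distinct H) (𝒮-distinct H') _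
      (λ {J} {J'} J≅J' → cong₂ ℤ._*_ (λ-≅ H' {J} {J'} J≅J') (w-resp J≅J'))
      (λ J J∉ → cong (ℤ._* w J) (λ-not-in-𝒮 H' J J∉))
      (𝒮-Sub⊆𝒮 H H'∈)

≡+⇒≡- : ∀ {a b c : ℤ} → a ≡ b ℤ.+ c → b ≡ a ℤ.- c
≡+⇒≡- {a} {b} {c} a≡b+c = sym (begin
  a ℤ.- c           ≡⟨ cong (λ z → z ℤ.- c) a≡b+c ⟩
  b ℤ.+ c ℤ.- c     ≡⟨ ℤₚ.+-assoc b c (- c) ⟩
  b ℤ.+ (c ℤ.- c)   ≡⟨ cong (λ z → b ℤ.+ z) (ℤₚ.+-inverseʳ c) ⟩
  b ℤ.+ + 0         ≡⟨ ℤₚ.+-identityʳ b ⟩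
  b                 ∎)
  where open ≡-Reasoning

comp-formula : ∀ s H → size H < s → NonEmpty H → Connected H → ∀ G → NonEmpty G → Connected G →
               + comp G H ≡ Λ (λ J → + hom G J) H
comp-formula (suc s) H (s≤s size<s) H-nonempty H-connected G G-nonempty G-connected = begin
  + comp G H
    ≡⟨ ≡+⇒≡- {c = ℤ∑.∑ (proper H) (λ H' → + μ H H' ℤ.* + comp G H')} hom≡comp+proper ⟩
  + hom G H ℤ.- ℤ∑.∑ (proper H) (λ H' → + μ H H' ℤ.* + comp G H')
    ≡⟨ cong (λ z → + hom G H ℤ.- z) (ℤ∑.∑-cong∈ (proper H) (λ H' H'∈ → cong (λ z → + μ H H' ℤ.* z) (induction H'∈))) ⟩
  + hom G H ℤ.- ℤ∑.∑ (proper H) (λ H' → + μ H H' ℤ.* Λ w H')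
    ≡⟨ Λ-recursion w (λ {J} {J'} → w-resp {J} {J'}) H H-nonempty H-connected ⟨
  Λ w H ∎
  where
  open ≡-Reasoning
  w : Graph → ℤ
  w J = + hom G J
  w-resp : ∀ {J J'} → J ≅ J' → w J ≡ w J'
  w-resp {J} {J'} J≅J' = cong +_ (hom-≃ G {J} {J'} (≅⇒≃ {J} {J'} J≅J'))
  induction : ∀ {H'} → H' ∈ proper H → + comp G H' ≡ Λ w H'
  induction {H'} H'∈ =
    let module M = SubMember (∈Sub⇒SubMember H (𝒮⊆Sub H (proj₁ (∈proper⁻ H H'∈))))
    in comp-formula s H' (ℕₚ.<-≤-trans (proper-size-< H H'∈) size<s) M.nonempty M.connected G G-nonempty G-connected
  hom≡comp+proper : + hom G H ≡ + comp G H ℤ.+ ℤ∑.∑ (proper H) (λ H' → + μ H H' ℤ.* + comp G H')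
  hom≡comp+proper = begin
    + hom G H
      ≡⟨ cong +_ (hom-split G H G-nonempty G-connected H-nonempty H-connected) ⟩
    + (comp G H ℕ.+ ∑ (proper H) (λ H' → μ H H' ℕ.* comp G H'))
      ≡⟨ ℤₚ.pos-+ (comp G H) (∑ (proper H) (λ H' → μ H H' ℕ.* comp G H')) ⟩
    + comp G H ℤ.+ + ∑ (proper H) (λ H' → μ H H' ℕ.* comp G H')
      ≡⟨ cong (λ z → + comp G H ℤ.+ z) (trans (ℤ∑-+ (proper H) _)
           (ℤ∑.∑-cong (proper H) (λ H' → ℤₚ.pos-* (μ H H') (comp G H')))) ⟩
    + comp G H ℤ.+ ℤ∑.∑ (proper H) (λ H' → + μ H H' ℤ.* + comp G H') ∎

theorem3p8 : (H : Graph) → NonEmpty H → Connected H →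
    (G : Graph) → NonEmpty G → Irreflexive G → Connected G →
    + comp G H ≡ sumℤ (map (λ J → λ[ H ] J ℤ.* + hom G J) (𝒮 H))
theorem3p8 H H-nonempty H-connected G G-nonempty _ G-connected =
  comp-formula (suc (size H)) H ℕₚ.≤-refl H-nonempty H-connected G G-nonempty G-connected
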